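{- Let $r\ge 2$, $\ell\ge1$, and let $C=(w_1,\dots,w_{2\ell+1})$ be a semi-valid tuple in $\Omega_n$ which is $(i,k)$-consecutive for some $i$ and some $1\le k\le\ell$. If each of the tuples $C_{i,k,-1}$, $C_{i,k,0}$, $C_{i,k,1}$ is semi-valid, then \[|H_n^{(r)}(C)|\ge\min\{|H_n^{(r)}(C_{i,k,-1})|,\,|H_n^{(r)}(C_{i,k,1})|\}.\] Moreover, this inequality is strict if $r\ge 3$ and $n\ge 3r-5$.
   Context: $\Omega_n=\{v_0,\dots,v_{n-1}\}$ carries the cyclic (clockwise) order $v_0<\dots<v_{n-1}<v_0$; indices of $v$ are modulo $n$ and indices of $w$ modulo $2\ell+1$. For $a,b\in\Omega_n$, $[a,b]$ is the set of points met travelling clockwise from $a$ to $b$, endpoints included. A tuple $C=(w_1,\dots,w_{2\ell+1})$ of distinct vertices is semi-valid if $w_1<w_3<\dots<w_{2\ell+1}<w_2<\dots<w_{2\ell}<w_1$ in the cyclic order (they appear clockwise in this order). For such $C$, $H_n^{(r)}(C)=\{e\in\binom{\Omega_n}{r}: e\cap[w_p,w_{p-1}]\neq\emptyset\text{ for all }p\}$. $C$ is $(i,k)$-consecutive if there is $j$ with $w_{i+2s}=v_{j+s}$ for all $0\le s<k$; in that case, for an integer $m$, $C_{i,k,m}=(w'_1,\dots,w'_{2\ell+1})$ where $w'_{i+2s}=v_{j+s+m}$ for $0\le s<k$ and $w'_p=w_p$ for all other $p$ (so $C_{i,k,0}=C$). -}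

module Defs where

open import Data.Nat using (ℕ; zero; suc; _+_; _*_; NonZero)
open import Data.Nat.DivMod using (_mod_)
open import Data.Fin as Fin using (Fin; toℕ; _≤_; _<_)
open import Data.Fin.Properties using (_≤?_; _<?_; any?; all?)
open import Data.Fin.Subset using (Subset; _∈_; ∣_∣)
open import Data.Fin.Subset.Properties using (_∈?_)
open import Data.Integer as ℤ using (ℤ; +_)
open import Data.Integer.DivMod using (_%ℕ_; n%ℕd<d)
open import Data.Vec using ([]; _∷_)
open import Data.Bool using (true; false)
open import Data.List using (List; [_]; map; _++_; filter; length)
open import Data.Product using (_×_; ∃; _,_)
open import Data.Sum using (_⊎_)
open import Relation.Nullary using (Dec; ¬_)
open import Relation.Nullary.Decidable using (_×-dec_; _⊎-dec_)
open import Relation.Binary.PropositionalEquality using (_≡_; _≢_)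
open import Function.Definitions using (Injective)
import Data.Nat.Properties as ℕP

len : ℕ → ℕ
len ℓ = suc (2 * ℓ)

-- A tuple of vertices of Ω_n = {v_0,…,v_{n-1}} (vertex v_a is represented by a : Fin n).
-- Entry p : Fin (len ℓ) (0-based) is the paper's w_{p+1}.
record Tuple (n ℓ : ℕ) : Set where
  constructor tuple
  field
    _⟨_⟩ : Fin (len ℓ) → Fin n
open Tuple public

vtx : ∀ n .{{_ : NonZero n}} → ℤ → Fin n
vtx n a = Fin.fromℕ< (n%ℕd<d a n)

widx : ∀ ℓ → ℕ → Fin (len ℓ)
widx ℓ a = a mod (len ℓ)

prev : ∀ {ℓ} → Fin (len ℓ) → Fin (len ℓ)
prev {ℓ} p = widx ℓ (toℕ p + 2 * ℓ)

-- x ∈ [a,b]: x is met when travelling clockwise from a to b (endpoints included).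
_∈[_,_] : ∀ {n} → Fin n → Fin n → Fin n → Set
x ∈[ a , b ] = (a ≤ b × a ≤ x × x ≤ b) ⊎ (b < a × (a ≤ x ⊎ x ≤ b))

_∈[_,_]? : ∀ {n} (x a b : Fin n) → Dec (x ∈[ a , b ])
x ∈[ a , b ]? = (a ≤? b ×-dec a ≤? x ×-dec x ≤? b) ⊎-dec (b <? a ×-dec (a ≤? x ⊎-dec x ≤? b))

-- A sequence x_0,…,x_{m-1} appears clockwise in this order: some rotation of it is
-- strictly increasing in the linear order v_0 < … < v_{n-1}.
CyclicallyOrdered : ∀ {n m} .{{_ : NonZero m}} → (Fin m → Fin n) → Set
CyclicallyOrdered {n} {m} x =
  ∃ λ (t : Fin m) → ∀ (q q′ : Fin m) → q < q′ →
    x ((toℕ t + toℕ q) mod m) < x ((toℕ t + toℕ q′) mod m)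

-- Semi-valid: distinct entries, and w_1 < w_3 < … < w_{2ℓ+1} < w_2 < … < w_{2ℓ} < w_1
-- cyclically.  The list w_1, w_3, …, w_{2ℓ+1}, w_2, …, w_{2ℓ} is, 0-based,
-- q ↦ entry (2q mod (2ℓ+1)), q = 0,…,2ℓ.
SemiValid : ∀ {n ℓ} → Tuple n ℓ → Set
SemiValid {n} {ℓ} w =
  Injective _≡_ _≡_ (w ⟨_⟩) × CyclicallyOrdered (λ (q : Fin (len ℓ)) → w ⟨ widx ℓ (2 * toℕ q) ⟩)

InH : ∀ {n ℓ} → ℕ → Tuple n ℓ → Subset n → Set
InH {n} {ℓ} r w e = ∣ e ∣ ≡ r × (∀ (p : Fin (len ℓ)) → ∃ λ x → x ∈ e × x ∈[ w ⟨ p ⟩ , w ⟨ prev {ℓ} p ⟩ ])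

InH? : ∀ {n ℓ} (r : ℕ) (w : Tuple n ℓ) (e : Subset n) → Dec (InH {n} {ℓ} r w e)
InH? {n} {ℓ} r w e = (ℕP._≟_ ∣ e ∣ r) ×-dec all? (λ (p : Fin (len ℓ)) → any? (λ x → (x ∈? e) ×-dec (x ∈[ w ⟨ p ⟩ , w ⟨ prev {ℓ} p ⟩ ]?)))

allSubsets : ∀ n → List (Subset n)
allSubsets zero = [ [] ]
allSubsets (suc n) = map (true ∷_) (allSubsets n) ++ map (false ∷_) (allSubsets n)

Hcard : ∀ {n ℓ} → ℕ → Tuple n ℓ → ℕ
Hcard {n} {ℓ} r w = length (filter (InH? {n} {ℓ} r w) (allSubsets n))

-- C is (i,k)-consecutive, witnessed by j: w_{i+2s} = v_{j+s} for 0 ≤ s < k.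
Consecutive : ∀ {n ℓ} .{{_ : NonZero n}} → Tuple n ℓ → Fin (len ℓ) → ℕ → Fin n → Set
Consecutive {n} {ℓ} w i k j =
  ∀ s → s Data.Nat.< k → w ⟨ widx ℓ (toℕ i + 2 * s) ⟩ ≡ vtx n (+ (toℕ j + s))

-- w′ = C_{i,k,m} (for C (i,k)-consecutive with witness j):
-- w′_{i+2s} = v_{j+s+m} for 0 ≤ s < k, and w′_p = w_p for all other p.
IsShift : ∀ {n ℓ} .{{_ : NonZero n}} → Tuple n ℓ → Fin (len ℓ) → ℕ → Fin n → ℤ → Tuple n ℓ → Set
IsShift {n} {ℓ} w i k j m w′ =
  (∀ s → s Data.Nat.< k → w′ ⟨ widx ℓ (toℕ i + 2 * s) ⟩ ≡ vtx n (+ (toℕ j + s) ℤ.+ m))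
  × (∀ p → (∀ s → s Data.Nat.< k → p ≢ widx ℓ (toℕ i + 2 * s)) → w′ ⟨ p ⟩ ≡ w ⟨ p ⟩)

module Submission where

open import Defs
open import Data.Nat using (ℕ; NonZero; _≤_; _<_; _*_; _∸_; _⊓_)
open import Data.Fin using (Fin)
open import Data.Integer using (+_; -[1+_])
open import Data.Product using (_×_)
open import Data.Nat using (_+_)
open import Data.Nat.Properties using (≮⇒≥; ≰⇒>; <⇒≱; ≤-trans; +-mono-≤; +-mono-<; m⊓n≤m; m⊓n≤n)
open import Data.Product using (_,_)
open import Relation.Binary.PropositionalEquality using (_≡_)
open import Function.Definitions using (Injective)

-- Measure positions clockwise from v_{j-1}. The block entries w_{i+2s} (s < k) of C₋, C and C₊
-- then sit at positions s, s+1 and s+2, while every other entry is common to the three tuples and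
-- lies at a position ≥ k+2. Let α = v_{j+k}, β = v_{j-1}, and let ρ rotate the vertices at
-- positions 0, …, k+1 one step forward. An edge of H(C₋) containing α is an edge of H(C), and
-- ρ maps an edge of H(C₋) avoiding α to an edge of H(C) avoiding β; symmetrically, with ρ⁻¹, for
-- C₊ with β and α exchanged. Splitting H(C) once by α and once by β gives
-- |H(C₋)| + |H(C₊)| ≤ 2 |H(C)|, hence the bound on the minimum.
--
-- For strictness, the entries w_{i+2u} appear in increasing positions D u, so the arcs of C are
-- [D u, D (u+ℓ)] and [D (ℓ+1+v), D v]. The set of positions {0, 1} ∪ (r−2 positions after D ℓ)
-- is an edge of H(C) containing β that misses the arc [2, D ℓ] of C₊. If it does not fit, then
-- n ≥ 3r − 5 forces D (k+ℓ) to be large, and {k, k+1} ∪ (r−2 positions before D (k+ℓ)) is an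
-- edge of H(C) containing α that misses the arc [D (k+ℓ), k−1] of C₋.

module Counting where

  open import Data.Nat using (ℕ; suc; _+_; _≤_; _<_; z≤n; s≤s)
  open import Data.Nat.Properties using (≤-trans; ≤-reflexive; ≤-antisym; +-suc; +-mono-≤; m≤n⇒m≤1+n)
  open import Data.List using (List; []; _∷_; _++_; map; filter; length)
  open import Data.List.Properties using (length-++; length-map)
  open import Data.List.Membership.Propositional using (_∈_)
  open import Data.List.Membership.Propositional.Properties using (∈-∃++; ∈-++⁻; ∈-++⁺ˡ; ∈-++⁺ʳ; ∈-filter⁺; ∈-filter⁻; ∈-map⁻)
  open import Data.List.Relation.Unary.Any using (here; there)
  open import Data.List.Relation.Unary.Unique.Propositional using (Unique; []; _∷_)
  open import Data.List.Relation.Unary.Unique.Propositional.Properties using (Unique[x∷xs]⇒x∉xs)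
  import Data.List.Relation.Unary.Unique.Propositional.Properties as Unique
  import Data.List.Relation.Unary.All as All
  open import Data.Product using (_×_; _,_; proj₁; proj₂)
  open import Data.Sum using (inj₁; inj₂)
  open import Data.Empty using (⊥-elim)
  open import Relation.Nullary using (yes; no; ¬_; ¬?)
  open import Relation.Nullary.Decidable using (_×-dec_)
  open import Relation.Unary using (Pred; Decidable)
  open import Level using (0ℓ)
  open import Relation.Binary.PropositionalEquality using (_≡_; _≢_; refl; sym; trans; cong)

  count : {A : Set} {P : Pred A 0ℓ} → Decidable P → List A → ℕ
  count P? xs = length (filter P? xs)

  module _ {A : Set} where

    Unique-⊆⇒length-≤ : ∀ {xs ys : List A} → Unique xs → (∀ {x} → x ∈ xs → x ∈ ys) →
      length xs ≤ length ys
    Unique-⊆⇒length-≤ {[]} _ _ = z≤n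
    Unique-⊆⇒length-≤ {x ∷ xs} {ys} u@(_ ∷ uxs) xs⊆ys with as , bs , refl ← ∈-∃++ (xs⊆ys (here refl)) =
      ≤-trans (s≤s (Unique-⊆⇒length-≤ uxs xs⊆as++bs)) (≤-reflexive length-as+x+bs)
      where
      x∉xs = Unique[x∷xs]⇒x∉xs u
      xs⊆as++bs : ∀ {y} → y ∈ xs → y ∈ as ++ bs
      xs⊆as++bs y∈xs with ∈-++⁻ as (xs⊆ys (there y∈xs))
      ... | inj₁ y∈as = ∈-++⁺ˡ y∈as
      ... | inj₂ (here refl) = ⊥-elim (x∉xs y∈xs)
      ... | inj₂ (there y∈bs) = ∈-++⁺ʳ as y∈bs
      length-as+x+bs : suc (length (as ++ bs)) ≡ length (as ++ x ∷ bs)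
      length-as+x+bs = trans (cong suc (length-++ as)) (trans (sym (+-suc (length as) (length bs))) (sym (length-++ as)))

  module _ {A : Set} {P Q : Pred A 0ℓ} (P? : Decidable P) (Q? : Decidable Q) where

    count-mono : (∀ {x} → P x → Q x) → ∀ xs → count P? xs ≤ count Q? xs
    count-mono P⊆Q [] = z≤n
    count-mono P⊆Q (x ∷ xs) with P? x | Q? x
    ... | yes _  | yes _  = s≤s (count-mono P⊆Q xs)
    ... | yes px | no ¬qx = ⊥-elim (¬qx (P⊆Q px))
    ... | no _   | yes _  = m≤n⇒m≤1+n (count-mono P⊆Q xs)
    ... | no _   | no _   = count-mono P⊆Q xs

    count-mono-< : (∀ {x} → P x → Q x) → ∀ {x xs} → x ∈ xs → Q x → ¬ P x → count P? xs < count Q? xs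
    count-mono-< P⊆Q {xs = y ∷ xs} (here refl) qx ¬px with P? y | Q? y
    ... | yes px | _      = ⊥-elim (¬px px)
    ... | no _   | yes _  = s≤s (count-mono P⊆Q xs)
    ... | no _   | no ¬qx = ⊥-elim (¬qx qx)
    count-mono-< P⊆Q {xs = y ∷ xs} (there x∈xs) qx ¬px with P? y | Q? y
    ... | yes _  | yes _  = s≤s (count-mono-< P⊆Q x∈xs qx ¬px)
    ... | yes py | no ¬qy = ⊥-elim (¬qy (P⊆Q py))
    ... | no _   | yes _  = m≤n⇒m≤1+n (count-mono-< P⊆Q x∈xs qx ¬px)
    ... | no _   | no _   = count-mono-< P⊆Q x∈xs qx ¬px

  module _ {A : Set} {P Q : Pred A 0ℓ} (P? : Decidable P) (Q? : Decidable Q) where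

    count-cong : (∀ {x} → P x → Q x) → (∀ {x} → Q x → P x) → ∀ xs → count P? xs ≡ count Q? xs
    count-cong P⊆Q Q⊆P xs = ≤-antisym (count-mono P? Q? P⊆Q xs) (count-mono Q? P? Q⊆P xs)

  module _ {A : Set} {P R : Pred A 0ℓ} (P? : Decidable P) (R? : Decidable R) where

    count-split : ∀ xs → count P? xs ≡ count (λ x → P? x ×-dec R? x) xs + count (λ x → P? x ×-dec ¬? (R? x)) xs
    count-split [] = refl
    count-split (x ∷ xs) with P? x | R? x
    ... | yes _ | yes _ = cong suc (count-split xs)
    ... | yes _ | no _  = trans (cong suc (count-split xs)) (sym (+-suc _ _))
    ... | no _  | yes _ = count-split xs
    ... | no _  | no _  = count-split xs

  map-injectiveOn⁺ : {A B : Set} (f : A → B) {xs : List A} → Unique xs →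
    (∀ {x y} → x ∈ xs → y ∈ xs → f x ≡ f y → x ≡ y) → Unique (map f xs)
  map-injectiveOn⁺ f {[]} [] _ = []
  map-injectiveOn⁺ f {x ∷ xs} u@(_ ∷ uxs) f-inj =
    All.tabulate fx≢ ∷ map-injectiveOn⁺ f uxs (λ a b → f-inj (there a) (there b))
    where
    fx≢ : ∀ {z} → z ∈ map f xs → f x ≢ z
    fx≢ z∈ fx≡z with y , y∈xs , refl ← ∈-map⁻ f z∈ with f-inj (here refl) (there y∈xs) fx≡z
    ... | refl = Unique[x∷xs]⇒x∉xs u y∈xs

  module _ {A B : Set} {P : Pred A 0ℓ} {Q : Pred B 0ℓ} (P? : Decidable P) (Q? : Decidable Q) where

    count-map : (f : B → A) → (∀ {x} → P (f x) → Q x) → (∀ {x} → Q x → P (f x)) →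
      ∀ xs → count P? (map f xs) ≡ count Q? xs
    count-map f _ _ [] = refl
    count-map f P∘f⊆Q Q⊆P∘f (x ∷ xs) with P? (f x) | Q? x
    ... | yes _   | yes _   = cong suc (count-map f P∘f⊆Q Q⊆P∘f xs)
    ... | yes pfx | no ¬qx  = ⊥-elim (¬qx (P∘f⊆Q pfx))
    ... | no ¬pfx | yes qx  = ⊥-elim (¬pfx (Q⊆P∘f qx))
    ... | no _    | no _    = count-map f P∘f⊆Q Q⊆P∘f xs

    count-≤-injection : ∀ {xs : List B} {ys : List A} → Unique xs → (f : B → A) →
      (∀ {x y} → x ∈ xs → y ∈ xs → f x ≡ f y → x ≡ y) →
      (∀ {x} → x ∈ xs → Q x → f x ∈ ys × P (f x)) → count Q? xs ≤ count P? ys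
    count-≤-injection {xs} {ys} uxs f f-inj f-maps =
      ≤-trans (≤-reflexive (sym (length-map f (filter Q? xs))))
        (Unique-⊆⇒length-≤ (map-injectiveOn⁺ f (Unique.filter⁺ Q? uxs) f-inj′) image⊆)
      where
      f-inj′ : ∀ {x y} → x ∈ filter Q? xs → y ∈ filter Q? xs → f x ≡ f y → x ≡ y
      f-inj′ x∈ y∈ = f-inj (proj₁ (∈-filter⁻ Q? x∈)) (proj₁ (∈-filter⁻ Q? y∈))
      image⊆ : ∀ {y} → y ∈ map f (filter Q? xs) → y ∈ filter P? ys
      image⊆ y∈ with x , x∈ , refl ← ∈-map⁻ f y∈ with x∈xs , qx ← ∈-filter⁻ Q? x∈ =
        ∈-filter⁺ P? (proj₁ (f-maps x∈xs qx)) (proj₂ (f-maps x∈xs qx))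

  module Exchange {A : Set} {U : List A} (U-unique : Unique U) (U-complete : ∀ x → x ∈ U)
    {P Q α β : Pred A 0ℓ} (P? : Decidable P) (Q? : Decidable Q) (α? : Decidable α) (β? : Decidable β)
    (P∩α⊆Q : ∀ {x} → P x → α x → Q x)
    (σ : A → A) (σ-injective : ∀ {x y} → σ x ≡ σ y → x ≡ y)
    (σ-maps : ∀ {x} → P x → ¬ α x → Q (σ x) × ¬ β (σ x)) where

    private
      Q∩α? = λ x → Q? x ×-dec α? x
      Q∩∁β? = λ x → Q? x ×-dec ¬? (β? x)
      P∩α? = λ x → P? x ×-dec α? x
      P∩∁α? = λ x → P? x ×-dec ¬? (α? x)

      P∩∁α≤Q∩∁β : count P∩∁α? U ≤ count Q∩∁β? U
      P∩∁α≤Q∩∁β = count-≤-injection Q∩∁β? P∩∁α? U-unique σ (λ _ _ → σ-injective)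
        (λ _ (px , ¬αx) → U-complete (σ _) , σ-maps px ¬αx)

    count-≤-exchange : count P? U ≤ count Q∩α? U + count Q∩∁β? U
    count-≤-exchange = ≤-trans (≤-reflexive (count-split P? α? U))
      (+-mono-≤ (count-mono P∩α? Q∩α? (λ (px , αx) → P∩α⊆Q px αx , αx) U) P∩∁α≤Q∩∁β)

    count-<-exchange : ∀ {x} → Q x → α x → ¬ P x → count P? U < count Q∩α? U + count Q∩∁β? U
    count-<-exchange qx αx ¬px = ≤-trans (≤-reflexive (cong suc (count-split P? α? U)))
      (+-mono-≤ (count-mono-< P∩α? Q∩α? (λ (py , αy) → P∩α⊆Q py αy , αy) (U-complete _) (qx , αx) (λ (px , _) → ¬px px))
                P∩∁α≤Q∩∁β)


module Enumeration where

  open Counting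
  open import Defs using (allSubsets)
  open import Data.Nat using (ℕ; zero; suc; _+_; _∸_; _≤_; _<_; _⊓_; _≤?_; _<?_)
  open import Data.Nat.Properties
  open import Data.Bool using (true; false)
  open import Data.Vec using ([]; _∷_; _[_]=_)
  open _[_]=_ using () renaming (there to vthere)
  open import Data.Vec.Properties using (∷-injectiveʳ)
  open import Data.Fin using (Fin) renaming (suc to fsuc)
  open import Function using (id)
  open import Data.Fin.Subset using (Subset; ∣_∣)
  open import Data.Fin.Subset.Properties using (_∈?_)
  open import Data.List using (List; _∷_; length; map; allFin; downFrom; tabulate)
  open import Data.List.Properties using (map-tabulate; filter-accept; filter-reject)
  open import Data.List.Membership.Propositional using (_∈_)
  open import Data.List.Membership.Propositional.Properties using (∈-++⁺ˡ; ∈-++⁺ʳ; ∈-map⁺; ∈-map⁻)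
  open import Data.List.Relation.Unary.Any using (here)
  open import Data.List.Relation.Unary.Unique.Propositional using (Unique; []; _∷_)
  import Data.List.Relation.Unary.Unique.Propositional.Properties as Unique
  import Data.List.Relation.Unary.All as All
  open import Data.Product using (_×_; _,_; proj₂)
  open import Relation.Nullary using (Dec; yes; no; ¬_; ¬?; contradiction)
  open import Relation.Unary using (Pred; Decidable)
  open import Level using (0ℓ)
  open import Relation.Nullary.Decidable using (_×-dec_; _⊎-dec_)
  open import Data.Sum using (_⊎_; inj₁; inj₂)
  open import Relation.Binary.PropositionalEquality using (_≡_; refl; sym; trans; cong; cong₂; module ≡-Reasoning)

  allSubsets-complete : ∀ n (e : Subset n) → e ∈ allSubsets n
  allSubsets-complete zero [] = here refl
  allSubsets-complete (suc n) (true ∷ e) = ∈-++⁺ˡ (∈-map⁺ (true ∷_) (allSubsets-complete n e))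
  allSubsets-complete (suc n) (false ∷ e) = ∈-++⁺ʳ _ (∈-map⁺ (false ∷_) (allSubsets-complete n e))

  allSubsets-unique : ∀ n → Unique (allSubsets n)
  allSubsets-unique zero = All.[] ∷ []
  allSubsets-unique (suc n) =
    Unique.++⁺ (Unique.map⁺ ∷-injectiveʳ (allSubsets-unique n))
               (Unique.map⁺ ∷-injectiveʳ (allSubsets-unique n)) heads-differ
    where
    heads-differ : ∀ {e} → ¬ (e ∈ map (true ∷_) (allSubsets n) × e ∈ map (false ∷_) (allSubsets n))
    heads-differ (e∈₁ , e∈₂) with ∈-map⁻ (true ∷_) e∈₁ | ∈-map⁻ (false ∷_) e∈₂
    ... | _ , _ , refl | _ , _ , ()

  count-∈-tail : ∀ {n} b (p : Subset n) →
    count (_∈? (b ∷ p)) (tabulate {n = n} fsuc) ≡ count (_∈? p) (allFin n)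
  count-∈-tail {n} b p = begin
    count (_∈? (b ∷ p)) (tabulate fsuc)        ≡⟨ cong (count (_∈? (b ∷ p))) (map-tabulate id fsuc) ⟨
    count (_∈? (b ∷ p)) (map fsuc (allFin n))  ≡⟨ count-map (_∈? (b ∷ p)) (_∈? p) fsuc (λ { (vthere x∈p) → x∈p }) vthere (allFin n) ⟩
    count (_∈? p) (allFin n)                      ∎
    where open ≡-Reasoning

  ∣p∣≡count-allFin : ∀ {n} (p : Subset n) → ∣ p ∣ ≡ count (_∈? p) (allFin n)
  ∣p∣≡count-allFin [] = refl
  ∣p∣≡count-allFin (true ∷ p) = cong suc (trans (∣p∣≡count-allFin p) (sym (count-∈-tail true p)))
  ∣p∣≡count-allFin (false ∷ p) = trans (∣p∣≡count-allFin p) (sym (count-∈-tail false p))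

  InRange : ℕ → ℕ → Pred ℕ 0ℓ
  InRange lo hi u = lo ≤ u × u < hi

  inRange? : ∀ lo hi → Decidable (InRange lo hi)
  inRange? lo hi u = lo ≤? u ×-dec u <? hi

  count-inRange-downFrom : ∀ lo hi m → count (inRange? lo hi) (downFrom m) ≡ hi ⊓ m ∸ lo
  count-inRange-downFrom lo hi zero = sym (trans (cong (_∸ lo) (⊓-zeroʳ hi)) (0∸n≡0 lo))
  count-inRange-downFrom lo hi (suc m) with inRange? lo hi m
  ... | yes m∈@(lo≤m , m<hi) = begin
    count (inRange? lo hi) (m ∷ downFrom m)   ≡⟨ cong length (filter-accept (inRange? lo hi) m∈) ⟩
    suc (count (inRange? lo hi) (downFrom m)) ≡⟨ cong suc (count-inRange-downFrom lo hi m) ⟩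
    suc (hi ⊓ m ∸ lo)                         ≡⟨ cong (λ x → suc (x ∸ lo)) (m≥n⇒m⊓n≡n (<⇒≤ m<hi)) ⟩
    suc (m ∸ lo)                              ≡⟨ +-∸-assoc 1 lo≤m ⟨
    suc m ∸ lo                                ≡⟨ cong (_∸ lo) (m≥n⇒m⊓n≡n m<hi) ⟨
    hi ⊓ suc m ∸ lo                           ∎
    where open ≡-Reasoning
  ... | no m∉ = trans (cong length (filter-reject (inRange? lo hi) m∉))
                      (trans (count-inRange-downFrom lo hi m) (same-bound (lo ≤? m)))
    where
    same-bound : Dec (lo ≤ m) → hi ⊓ m ∸ lo ≡ hi ⊓ suc m ∸ lo
    same-bound (yes lo≤m) = cong (_∸ lo) (trans (m≤n⇒m⊓n≡m hi≤m) (sym (m≤n⇒m⊓n≡m (≤-trans hi≤m (n≤1+n m)))))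
      where hi≤m = ≮⇒≥ (λ m<hi → m∉ (lo≤m , m<hi))
    same-bound (no lo≰m) = trans (m≤n⇒m∸n≡0 (≤-trans (m⊓n≤n hi m) (<⇒≤ m<lo)))
                                (sym (m≤n⇒m∸n≡0 (≤-trans (m⊓n≤n hi (suc m)) m<lo)))
      where m<lo = ≰⇒> lo≰m

  count-inRanges-downFrom : ∀ {a b c d m} → b ≤ c → c ≤ d → d ≤ m →
    count (λ u → inRange? a b u ⊎-dec inRange? c d u) (downFrom m) ≡ (b ∸ a) + (d ∸ c)
  count-inRanges-downFrom {a} {b} {c} {d} {m} b≤c c≤d d≤m = begin
    count P? (downFrom m)                                                       ≡⟨ count-split P? (inRange? a b) (downFrom m) ⟩
    count (λ u → P? u ×-dec inRange? a b u) (downFrom m)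
      + count (λ u → P? u ×-dec ¬? (inRange? a b u)) (downFrom m)               ≡⟨ cong₂ _+_ first second ⟩
    (b ⊓ m ∸ a) + (d ⊓ m ∸ c)                                                   ≡⟨ cong₂ (λ x y → (x ∸ a) + (y ∸ c)) (m≤n⇒m⊓n≡m b≤m) (m≤n⇒m⊓n≡m d≤m) ⟩
    (b ∸ a) + (d ∸ c)                                                           ∎
    where
    open ≡-Reasoning
    P? = λ u → inRange? a b u ⊎-dec inRange? c d u
    b≤m = ≤-trans b≤c (≤-trans c≤d d≤m)
    first = trans (count-cong _ (inRange? a b) proj₂ (λ u∈ → inj₁ u∈ , u∈) (downFrom m))
                  (count-inRange-downFrom a b m)
    second = trans (count-cong _ (inRange? c d) only-second (λ u∈@(c≤u , _) → inj₂ u∈ , λ (_ , u<b) → <⇒≱ u<b (≤-trans b≤c c≤u)) (downFrom m))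
                   (count-inRange-downFrom c d m)
      where
      only-second : ∀ {u} → (InRange a b u ⊎ InRange c d u) × ¬ InRange a b u → InRange c d u
      only-second (inj₁ u∈ , u∉) = contradiction u∈ u∉
      only-second (inj₂ u∈ , _) = u∈


module FinSubset where

  open Counting
  open Enumeration
  open import Data.Nat using (ℕ)
  open import Data.Nat.Properties using (≤-antisym)
  open import Data.Bool using (true)
  open import Data.Vec using (tabulate)
  open import Data.Vec.Properties using ([]=⇒lookup; lookup⇒[]=; lookup∘tabulate)
  open import Data.Fin using (Fin)
  open import Data.Fin.Subset using (Subset; ∣_∣; _∈_)
  open import Data.Fin.Subset.Properties using (_∈?_; ⊆-antisym)
  open import Data.Fin.Permutation using (Permutation′; _⟨$⟩ʳ_; _⟨$⟩ˡ_; inverseˡ; inverseʳ)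
  open import Data.List using (allFin)
  open import Data.List.Membership.Propositional.Properties using (∈-allFin)
  open import Data.List.Relation.Unary.Unique.Propositional.Properties using (allFin⁺)
  open import Data.Product using (_,_)
  open import Relation.Nullary using (yes; no; contradiction)
  open import Relation.Nullary.Decidable using (⌊_⌋)
  open import Relation.Unary using (Pred; Decidable)
  open import Level using (0ℓ)
  open import Relation.Binary.PropositionalEquality using (_≡_; refl; sym; trans; cong; subst)

  module _ {n : ℕ} {P : Pred (Fin n) 0ℓ} (P? : Decidable P) where

    subsetOf : Subset n
    subsetOf = tabulate (λ x → ⌊ P? x ⌋)

    ∈-subsetOf⁺ : ∀ {x} → P x → x ∈ subsetOf
    ∈-subsetOf⁺ {x} px = lookup⇒[]= x subsetOf (trans (lookup∘tabulate _ x) ⌊P?x⌋≡true)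
      where
      ⌊P?x⌋≡true : ⌊ P? x ⌋ ≡ true
      ⌊P?x⌋≡true with P? x
      ... | yes _  = refl
      ... | no ¬px = contradiction px ¬px

    ∈-subsetOf⁻ : ∀ {x} → x ∈ subsetOf → P x
    ∈-subsetOf⁻ {x} x∈ with P? x | trans (sym (lookup∘tabulate (λ y → ⌊ P? y ⌋) x)) ([]=⇒lookup x∈)
    ... | yes px | _ = px
    ... | no _   | ()

    ∣subsetOf∣ : ∣ subsetOf ∣ ≡ count P? (allFin n)
    ∣subsetOf∣ = trans (∣p∣≡count-allFin subsetOf)
      (count-cong (_∈? subsetOf) P? ∈-subsetOf⁻ ∈-subsetOf⁺ (allFin n))

  module _ {n : ℕ} (π : Permutation′ n) where

    image : Subset n → Subset n
    image e = subsetOf (λ y → (π ⟨$⟩ˡ y) ∈? e)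

    ∈-image⁺ : ∀ {e x} → x ∈ e → π ⟨$⟩ʳ x ∈ image e
    ∈-image⁺ {e} x∈e = ∈-subsetOf⁺ (λ y → (π ⟨$⟩ˡ y) ∈? e) (subst (_∈ e) (sym (inverseˡ π)) x∈e)

    ∈-image⁻ : ∀ {e y} → y ∈ image e → π ⟨$⟩ˡ y ∈ e
    ∈-image⁻ {e} = ∈-subsetOf⁻ (λ y → (π ⟨$⟩ˡ y) ∈? e)

    ∣image∣ : ∀ e → ∣ image e ∣ ≡ ∣ e ∣
    ∣image∣ e = trans (∣p∣≡count-allFin (image e)) (trans (≤-antisym image≤e e≤image) (sym (∣p∣≡count-allFin e)))
      where
      image≤e = count-≤-injection (_∈? e) (_∈? image e) (allFin⁺ n) (π ⟨$⟩ˡ_)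
        (λ _ _ eq → trans (sym (inverseʳ π)) (trans (cong (π ⟨$⟩ʳ_) eq) (inverseʳ π)))
        (λ _ y∈ → ∈-allFin _ , ∈-image⁻ y∈)
      e≤image = count-≤-injection (_∈? image e) (_∈? e) (allFin⁺ n) (π ⟨$⟩ʳ_)
        (λ _ _ eq → trans (sym (inverseˡ π)) (trans (cong (π ⟨$⟩ˡ_) eq) (inverseˡ π)))
        (λ _ x∈ → ∈-allFin _ , ∈-image⁺ x∈)

    image-injective : ∀ {e e′} → image e ≡ image e′ → e ≡ e′
    image-injective {e} {e′} eq = ⊆-antisym (transfer eq) (transfer (sym eq))
      where
      transfer : ∀ {d d′} → image d ≡ image d′ → ∀ {x} → x ∈ d → x ∈ d′
      transfer {d′ = d′} eq x∈d = subst (_∈ d′) (inverseˡ π) (∈-image⁻ (subst (_ ∈_) eq (∈-image⁺ x∈d)))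


module CyclicDistance where

  open import Data.Nat using (ℕ; _+_; _∸_; _≤_; _<_; NonZero; _≤?_; _<?_)
  open import Data.Nat.Properties
  open import Data.Nat.DivMod using (_%_; %-distribˡ-+; m%n%n≡m%n; [m+n]%n≡m%n; m<n⇒m%n≡m; m%n<n; m≤n⇒[n∸m]%m≡n%m)
  open import Data.Product using (_×_; _,_)
  open import Data.Sum using (_⊎_; inj₁; inj₂)
  open import Data.Empty using (⊥-elim)
  open import Relation.Nullary using (yes; no)
  open import Relation.Binary.PropositionalEquality using (_≡_; refl; sym; trans; cong; subst₂; module ≡-Reasoning)

  -- For x a c : Fin n, x ∈[ a , c ] (from Defs) unfolds to toℕ x ∈ℕ[ toℕ a , toℕ c ].
  _∈ℕ[_,_] : ℕ → ℕ → ℕ → Set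
  x ∈ℕ[ a , c ] = (a ≤ c × a ≤ x × x ≤ c) ⊎ (c < a × (a ≤ x ⊎ x ≤ c))

  module _ (n : ℕ) .{{_ : NonZero n}} where
    open ≡-Reasoning

    [m%n+k]%n≡[m+k]%n : ∀ m k → (m % n + k) % n ≡ (m + k) % n
    [m%n+k]%n≡[m+k]%n m k = begin
      (m % n + k) % n          ≡⟨ %-distribˡ-+ (m % n) k n ⟩
      (m % n % n + k % n) % n  ≡⟨ cong (λ z → (z + k % n) % n) (m%n%n≡m%n m n) ⟩
      (m % n + k % n) % n      ≡⟨ %-distribˡ-+ m k n ⟨
      (m + k) % n              ∎

    [k+m%n]%n≡[k+m]%n : ∀ k m → (k + m % n) % n ≡ (k + m) % n
    [k+m%n]%n≡[k+m]%n k m = begin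
      (k + m % n) % n  ≡⟨ cong (_% n) (+-comm k (m % n)) ⟩
      (m % n + k) % n  ≡⟨ [m%n+k]%n≡[m+k]%n m k ⟩
      (m + k) % n      ≡⟨ cong (_% n) (+-comm m k) ⟩
      (k + m) % n      ∎

    -- Clockwise distance from a to x in ℤ/nℤ, for a ≤ n.
    cdist : ℕ → ℕ → ℕ
    cdist a x = (x + (n ∸ a)) % n

    cdist<n : ∀ a x → cdist a x < n
    cdist<n a x = m%n<n (x + (n ∸ a)) n

    private
      a+[x+[n∸a]]≡x+n : ∀ {a} x → a ≤ n → a + (x + (n ∸ a)) ≡ x + n
      a+[x+[n∸a]]≡x+n {a} x a≤n = begin
        a + (x + (n ∸ a))  ≡⟨ +-assoc a x (n ∸ a) ⟨
        a + x + (n ∸ a)    ≡⟨ cong (_+ (n ∸ a)) (+-comm a x) ⟩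
        x + a + (n ∸ a)    ≡⟨ +-assoc x a (n ∸ a) ⟩
        x + (a + (n ∸ a))  ≡⟨ cong (λ z → x + z) (m+[n∸m]≡n a≤n) ⟩
        x + n              ∎

    +-cdist : ∀ {a} x → a ≤ n → (a + cdist a x) % n ≡ x % n
    +-cdist {a} x a≤n = begin
      (a + (x + (n ∸ a)) % n) % n  ≡⟨ [k+m%n]%n≡[k+m]%n a (x + (n ∸ a)) ⟩
      (a + (x + (n ∸ a))) % n      ≡⟨ cong (_% n) (a+[x+[n∸a]]≡x+n x a≤n) ⟩
      (x + n) % n                  ≡⟨ [m+n]%n≡m%n x n ⟩
      x % n                        ∎

    cdist-unique : ∀ {a d} x → a ≤ n → d < n → (a + d) % n ≡ x % n → cdist a x ≡ d
    cdist-unique {a} {d} x a≤n d<n a+d≡x = begin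
      (x + (n ∸ a)) % n            ≡⟨ [m%n+k]%n≡[m+k]%n x (n ∸ a) ⟨
      (x % n + (n ∸ a)) % n        ≡⟨ cong (λ z → (z + (n ∸ a)) % n) a+d≡x ⟨
      ((a + d) % n + (n ∸ a)) % n  ≡⟨ [m%n+k]%n≡[m+k]%n (a + d) (n ∸ a) ⟩
      (a + d + (n ∸ a)) % n        ≡⟨ cong (_% n) (+-assoc a d (n ∸ a)) ⟩
      (a + (d + (n ∸ a))) % n      ≡⟨ cong (_% n) (a+[x+[n∸a]]≡x+n d a≤n) ⟩
      (d + n) % n                  ≡⟨ [m+n]%n≡m%n d n ⟩
      d % n                        ≡⟨ m<n⇒m%n≡m d<n ⟩
      d                            ∎

    cdist-≤ : ∀ {a x} → a ≤ x → x < n → cdist a x ≡ x ∸ a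
    cdist-≤ {a} {x} a≤x x<n = cdist-unique x (≤-trans a≤x (<⇒≤ x<n)) (≤-<-trans (m∸n≤m x a) x<n)
      (cong (_% n) (m+[n∸m]≡n a≤x))

    cdist-> : ∀ {a x} → x < a → a ≤ n → cdist a x ≡ x + (n ∸ a)
    cdist-> {a} {x} x<a a≤n = cdist-unique x a≤n x+[n∸a]<n
      (trans (cong (_% n) (a+[x+[n∸a]]≡x+n x a≤n)) ([m+n]%n≡m%n x n))
      where
      x+[n∸a]<n : x + (n ∸ a) < n
      x+[n∸a]<n = subst₂ _<_ (+-comm (n ∸ a) x) (m∸n+n≡m a≤n) (+-monoʳ-< (n ∸ a) x<a)

    cdist-cdist : ∀ {b a x} → b < n → a < n → cdist (cdist b a) (cdist b x) ≡ cdist a x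
    cdist-cdist {b} {a} {x} b<n a<n = sym (cdist-unique x (<⇒≤ a<n) (cdist<n pa px) a+d≡x)
      where
      pa = cdist b a
      px = cdist b x
      d = cdist pa px
      a+d≡x : (a + d) % n ≡ x % n
      a+d≡x = begin
        (a + d) % n             ≡⟨ [m%n+k]%n≡[m+k]%n a d ⟨
        (a % n + d) % n         ≡⟨ cong (λ z → (z + d) % n) (+-cdist a (<⇒≤ b<n)) ⟨
        ((b + pa) % n + d) % n  ≡⟨ [m%n+k]%n≡[m+k]%n (b + pa) d ⟩
        (b + pa + d) % n        ≡⟨ cong (_% n) (+-assoc b pa d) ⟩
        (b + (pa + d)) % n      ≡⟨ [k+m%n]%n≡[k+m]%n b (pa + d) ⟨
        (b + (pa + d) % n) % n  ≡⟨ cong (λ z → (b + z) % n) (+-cdist px (<⇒≤ (cdist<n b a))) ⟩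
        (b + px % n) % n        ≡⟨ [k+m%n]%n≡[k+m]%n b px ⟩
        (b + px) % n            ≡⟨ +-cdist x (<⇒≤ b<n) ⟩
        x % n                   ∎

    ∈ℕ[]⇒cdist-≤ : ∀ {a x c} → a < n → x < n → c < n → x ∈ℕ[ a , c ] → cdist a x ≤ cdist a c
    ∈ℕ[]⇒cdist-≤ {a} {x} {c} a<n x<n c<n (inj₁ (a≤c , a≤x , x≤c))
      rewrite cdist-≤ a≤x x<n | cdist-≤ a≤c c<n = ∸-monoˡ-≤ a x≤c
    ∈ℕ[]⇒cdist-≤ {a} {x} {c} a<n x<n c<n (inj₂ (c<a , inj₁ a≤x))
      rewrite cdist-≤ a≤x x<n | cdist-> c<a (<⇒≤ a<n) = ≤-trans (∸-monoˡ-≤ a (<⇒≤ x<n)) (m≤n+m (n ∸ a) c)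
    ∈ℕ[]⇒cdist-≤ {a} {x} {c} a<n x<n c<n (inj₂ (c<a , inj₂ x≤c))
      rewrite cdist-> (≤-<-trans x≤c c<a) (<⇒≤ a<n) | cdist-> c<a (<⇒≤ a<n) = +-monoˡ-≤ (n ∸ a) x≤c

    cdist-≤⇒∈ℕ[] : ∀ {a x c} → a < n → x < n → c < n → cdist a x ≤ cdist a c → x ∈ℕ[ a , c ]
    cdist-≤⇒∈ℕ[] {a} {x} {c} a<n x<n c<n h with a ≤? c | a ≤? x
    ... | yes a≤c | yes a≤x rewrite cdist-≤ a≤x x<n | cdist-≤ a≤c c<n =
      inj₁ (a≤c , a≤x , subst₂ _≤_ (m∸n+n≡m a≤x) (m∸n+n≡m a≤c) (+-monoˡ-≤ a h))
    ... | yes a≤c | no a≰x rewrite cdist-> (≰⇒> a≰x) (<⇒≤ a<n) | cdist-≤ a≤c c<n =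
      ⊥-elim (<⇒≱ (<-≤-trans (∸-monoˡ-< c<n a≤c) (m≤n+m (n ∸ a) x)) h)
    ... | no a≰c | yes a≤x = inj₂ (≰⇒> a≰c , inj₁ a≤x)
    ... | no a≰c | no a≰x rewrite cdist-> (≰⇒> a≰x) (<⇒≤ a<n) | cdist-> (≰⇒> a≰c) (<⇒≤ a<n) =
      inj₂ (≰⇒> a≰c , inj₂ (+-cancelʳ-≤ (n ∸ a) x c h))

  module _ (n : ℕ) .{{_ : NonZero n}} (L : ℕ) .{{_ : NonZero L}} (R : ℕ → ℕ)
    (R<n : ∀ {v} → v < L → R v < n) (R-mono : ∀ {v v′} → v < v′ → v′ < L → R v < R v′) where

    private
      R-mono-≤ : ∀ {v v′} → v ≤ v′ → v′ < L → R v ≤ R v′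
      R-mono-≤ v≤v′ v′<L with m≤n⇒m<n∨m≡n v≤v′
      ... | inj₁ v<v′ = <⇒≤ (R-mono v<v′ v′<L)
      ... | inj₂ refl = ≤-refl

      [L+w]%L : ∀ {w} → L ≤ w → w < L + L → w % L ≡ w ∸ L
      [L+w]%L {w} L≤w w<2L = trans (sym (m≤n⇒[n∸m]%m≡n%m L≤w))
        (m<n⇒m%n≡m (+-cancelʳ-< L (w ∸ L) L (subst₂ _<_ (sym (m∸n+n≡m L≤w)) refl w<2L)))

      wrapped< : ∀ {c u} → u < L → L ≤ c + u → c + u ∸ L < c
      wrapped< {c} {u} u<L L≤c+u =
        +-cancelʳ-< L (c + u ∸ L) c (subst₂ _<_ (sym (m∸n+n≡m L≤c+u)) refl (+-monoʳ-< c u<L))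

    cdist-rotate-mono : ∀ {c u u′} → c < L → u < u′ → u′ < L →
      cdist n (R c) (R ((c + u) % L)) < cdist n (R c) (R ((c + u′) % L))
    cdist-rotate-mono {c} {u} {u′} c<L u<u′ u′<L with c + u′ <? L
    ... | yes c+u′<L with c+u<L ← <-trans (+-monoʳ-< c u<u′) c+u′<L
        rewrite m<n⇒m%n≡m c+u′<L | m<n⇒m%n≡m c+u<L
        | cdist-≤ n (R-mono-≤ (m≤m+n c u) c+u<L) (R<n c+u<L)
        | cdist-≤ n (R-mono-≤ (m≤m+n c u′) c+u′<L) (R<n c+u′<L) =
        ∸-monoˡ-< (R-mono (+-monoʳ-< c u<u′) c+u′<L) (R-mono-≤ (m≤m+n c u) c+u<L)
    ... | no c+u′≮L with c + u <? L
    ...   | yes c+u<L rewrite m<n⇒m%n≡m c+u<L | [L+w]%L (≮⇒≥ c+u′≮L) (+-mono-< c<L u′<L)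
        | cdist-≤ n (R-mono-≤ (m≤m+n c u) c+u<L) (R<n c+u<L)
        | cdist-> n (R-mono (wrapped< u′<L (≮⇒≥ c+u′≮L)) c<L) (<⇒≤ (R<n c<L)) =
        <-≤-trans (∸-monoˡ-< (R<n c+u<L) (R-mono-≤ (m≤m+n c u) c+u<L)) (m≤n+m (n ∸ R c) (R (c + u′ ∸ L)))
    ...   | no c+u≮L rewrite [L+w]%L (≮⇒≥ c+u≮L) (+-mono-< c<L (<-trans u<u′ u′<L))
        | [L+w]%L (≮⇒≥ c+u′≮L) (+-mono-< c<L u′<L)
        | cdist-> n (R-mono (wrapped< (<-trans u<u′ u′<L) (≮⇒≥ c+u≮L)) c<L) (<⇒≤ (R<n c<L))
        | cdist-> n (R-mono (wrapped< u′<L (≮⇒≥ c+u′≮L)) c<L) (<⇒≤ (R<n c<L)) =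
        +-monoˡ-< (n ∸ R c) (R-mono (∸-monoˡ-< (+-monoʳ-< c u<u′) (≮⇒≥ c+u≮L)) (<-trans (wrapped< u′<L (≮⇒≥ c+u′≮L)) c<L))

  ∈ℕ[]-linear⁻ : ∀ {a x c} → a ≤ c → x ∈ℕ[ a , c ] → a ≤ x × x ≤ c
  ∈ℕ[]-linear⁻ a≤c (inj₁ (_ , a≤x , x≤c)) = a≤x , x≤c
  ∈ℕ[]-linear⁻ a≤c (inj₂ (c<a , _)) = ⊥-elim (<⇒≱ c<a a≤c)

  ∈ℕ[]-linear⁺ : ∀ {a x c} → a ≤ x → x ≤ c → x ∈ℕ[ a , c ]
  ∈ℕ[]-linear⁺ a≤x x≤c = inj₁ (≤-trans a≤x x≤c , a≤x , x≤c)

  ∈ℕ[]-wrapping⁻ : ∀ {a x c} → c < a → x ∈ℕ[ a , c ] → a ≤ x ⊎ x ≤ c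
  ∈ℕ[]-wrapping⁻ c<a (inj₁ (a≤c , _)) = ⊥-elim (<⇒≱ c<a a≤c)
  ∈ℕ[]-wrapping⁻ c<a (inj₂ (_ , x∈)) = x∈

  ∈ℕ[]-wrapping⁺ : ∀ {a x c} → c < a → a ≤ x ⊎ x ≤ c → x ∈ℕ[ a , c ]
  ∈ℕ[]-wrapping⁺ c<a x∈ = inj₂ (c<a , x∈)


module Positions (n : ℕ) .{{_ : NonZero n}} (b : ℕ) (b<n : b < n) where

  open Counting
  open Enumeration
  open FinSubset
  open CyclicDistance
  open import Defs using (_∈[_,_])
  open import Data.Nat using (ℕ; _+_; _≤_; _<_; NonZero)
  open import Data.Nat.Properties using (<⇒≤; ≤-antisym)
  open import Data.Nat.DivMod using (_%_; m%n%n≡m%n; m<n⇒m%n≡m; m%n<n)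
  open import Data.Fin using (Fin; toℕ; fromℕ<)
  open import Data.Fin.Properties using (toℕ-fromℕ<; toℕ<n; toℕ-injective)
  open import Data.Fin.Subset using (Subset; ∣_∣)
  open import Data.List using (downFrom)
  open import Data.List.Membership.Propositional.Properties using (∈-allFin; ∈-downFrom⁺; ∈-downFrom⁻)
  open import Data.List.Relation.Unary.Unique.Propositional.Properties using (allFin⁺; downFrom⁺)
  open import Data.Product using (_,_)
  open import Relation.Unary using (Pred; Decidable)
  open import Level using (0ℓ)
  open import Relation.Binary.PropositionalEquality using (_≡_; sym; trans; cong; subst; subst₂; module ≡-Reasoning)

  pos : Fin n → ℕ
  pos x = cdist n b (toℕ x)

  pos<n : ∀ x → pos x < n
  pos<n x = cdist<n n b (toℕ x)

  unpos : ℕ → Fin n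
  unpos u = fromℕ< (m%n<n (b + u) n)

  pos-unpos : ∀ {u} → u < n → pos (unpos u) ≡ u
  pos-unpos {u} u<n = cdist-unique n (toℕ (unpos u)) (<⇒≤ b<n) u<n
    (trans (sym (m%n%n≡m%n (b + u) n)) (cong (_% n) (sym (toℕ-fromℕ< (m%n<n (b + u) n)))))

  unpos-pos : ∀ x → unpos (pos x) ≡ x
  unpos-pos x = toℕ-injective (begin
    toℕ (unpos (pos x))  ≡⟨ toℕ-fromℕ< _ ⟩
    (b + pos x) % n      ≡⟨ +-cdist n (toℕ x) (<⇒≤ b<n) ⟩
    toℕ x % n            ≡⟨ m<n⇒m%n≡m (toℕ<n x) ⟩
    toℕ x                ∎)
    where open ≡-Reasoning

  pos-injective : ∀ {x y} → pos x ≡ pos y → x ≡ y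
  pos-injective {x} {y} eq = trans (sym (unpos-pos x)) (trans (cong unpos eq) (unpos-pos y))

  pos-∈[]⁺ : ∀ {a x c} → x ∈[ a , c ] → pos x ∈ℕ[ pos a , pos c ]
  pos-∈[]⁺ {a} {x} {c} x∈ = cdist-≤⇒∈ℕ[] n (pos<n a) (pos<n x) (pos<n c)
    (subst₂ _≤_ (sym (cdist-cdist n b<n (toℕ<n a))) (sym (cdist-cdist n b<n (toℕ<n a)))
      (∈ℕ[]⇒cdist-≤ n (toℕ<n a) (toℕ<n x) (toℕ<n c) x∈))

  pos-∈[]⁻ : ∀ {a x c} → pos x ∈ℕ[ pos a , pos c ] → x ∈[ a , c ]
  pos-∈[]⁻ {a} {x} {c} x∈ = cdist-≤⇒∈ℕ[] n (toℕ<n a) (toℕ<n x) (toℕ<n c)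
    (subst₂ _≤_ (cdist-cdist n b<n (toℕ<n a)) (cdist-cdist n b<n (toℕ<n a))
      (∈ℕ[]⇒cdist-≤ n (pos<n a) (pos<n x) (pos<n c) x∈))

  module _ {P : Pred ℕ 0ℓ} (P? : Decidable P) where

    atPositions : Subset n
    atPositions = subsetOf (λ x → P? (pos x))

    ∣atPositions∣ : ∣ atPositions ∣ ≡ count P? (downFrom n)
    ∣atPositions∣ = trans (∣subsetOf∣ (λ x → P? (pos x))) (≤-antisym pos-maps unpos-maps)
      where
      pos-maps = count-≤-injection P? (λ x → P? (pos x)) (allFin⁺ n) pos
        (λ _ _ → pos-injective) (λ _ p → ∈-downFrom⁺ (pos<n _) , p)
      unpos-maps = count-≤-injection (λ x → P? (pos x)) P? (downFrom⁺ n) unpos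
        (λ u∈ v∈ eq → trans (sym (pos-unpos (∈-downFrom⁻ u∈))) (trans (cong pos eq) (pos-unpos (∈-downFrom⁻ v∈))))
        (λ u∈ p → ∈-allFin _ , subst P (sym (pos-unpos (∈-downFrom⁻ u∈))) p)


module Rotation (k : ℕ) where

  open CyclicDistance
  open import Data.Nat using (ℕ; zero; suc; _≤_; _<_; z≤n; s≤s; _≤?_; _≟_)
  open import Data.Nat.Properties
  open import Data.Product using (_×_; _,_)
  open import Data.Sum using (_⊎_; inj₁; inj₂)
  open import Data.Empty using (⊥-elim)
  open import Relation.Nullary using (Dec; yes; no; contradiction)
  open import Function using (_∘_)
  open import Relation.Binary.PropositionalEquality using (_≡_; _≢_; refl; sym; trans; cong; subst)

  rotate : ℕ → ℕ
  rotate u with u ≤? k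
  ... | yes _ = suc u
  ... | no _ with u ≟ suc k
  ...   | yes _ = 0
  ...   | no _ = u

  unrotate : ℕ → ℕ
  unrotate zero = suc k
  unrotate (suc u) with suc u ≤? suc k
  ... | yes _ = u
  ... | no _ = suc u

  rotate-cases : ∀ u → u ≢ suc k → (u ≤ k × rotate u ≡ suc u) ⊎ (suc (suc k) ≤ u × rotate u ≡ u)
  rotate-cases u u≢1+k with u ≤? k
  ... | yes u≤k = inj₁ (u≤k , refl)
  ... | no u≰k with u ≟ suc k
  ...   | yes u≡1+k = contradiction u≡1+k u≢1+k
  ...   | no _ = inj₂ (≤∧≢⇒< (≰⇒> u≰k) (u≢1+k ∘ sym) , refl)

  unrotate-cases : ∀ u → u ≢ 0 → (u ≤ suc k × suc (unrotate u) ≡ u) ⊎ (suc (suc k) ≤ u × unrotate u ≡ u)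
  unrotate-cases zero u≢0 = contradiction refl u≢0
  unrotate-cases (suc u) _ with suc u ≤? suc k
  ... | yes 1+u≤1+k = inj₁ (1+u≤1+k , refl)
  ... | no 1+u≰1+k = inj₂ (≰⇒> 1+u≰1+k , refl)

  rotate-[1+k] : rotate (suc k) ≡ 0
  rotate-[1+k] with suc k ≤? k
  ... | yes 1+k≤k = contradiction 1+k≤k (n≮n k)
  ... | no _ with suc k ≟ suc k
  ...   | yes _ = refl
  ...   | no 1+k≢1+k = contradiction refl 1+k≢1+k

  rotate-≤ : ∀ {u} → u ≤ k → rotate u ≡ suc u
  rotate-≤ {u} u≤k with u ≤? k
  ... | yes _ = refl
  ... | no u≰k = contradiction u≤k u≰k

  rotate-≥ : ∀ {u} → suc (suc k) ≤ u → rotate u ≡ u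
  rotate-≥ {u} k+2≤u with rotate-cases u (λ u≡1+k → <-irrefl (sym u≡1+k) k+2≤u)
  ... | inj₁ (u≤k , _) = contradiction (≤-trans (n≤1+n (suc k)) (≤-trans k+2≤u u≤k)) (n≮n k)
  ... | inj₂ (_ , eq) = eq

  unrotate-≤ : ∀ {u} → u ≤ k → unrotate (suc u) ≡ u
  unrotate-≤ {u} u≤k with suc u ≤? suc k
  ... | yes _ = refl
  ... | no 1+u≰1+k = contradiction (s≤s u≤k) 1+u≰1+k

  unrotate-≥ : ∀ {u} → suc (suc k) ≤ u → unrotate u ≡ u
  unrotate-≥ {suc u} (s≤s k+1≤u) with suc u ≤? suc k
  ... | yes 1+u≤1+k = contradiction 1+u≤1+k (<⇒≱ (s≤s k+1≤u))
  ... | no _ = refl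

  unrotate-rotate : ∀ u → unrotate (rotate u) ≡ u
  unrotate-rotate u = by-cases (u ≤? k) (u ≟ suc k)
    where
    by-cases : Dec (u ≤ k) → Dec (u ≡ suc k) → unrotate (rotate u) ≡ u
    by-cases (yes u≤k) _ = trans (cong unrotate (rotate-≤ u≤k)) (unrotate-≤ u≤k)
    by-cases (no _) (yes refl) = cong unrotate rotate-[1+k]
    by-cases (no u≰k) (no u≢1+k) = trans (cong unrotate (rotate-≥ k+2≤u)) (unrotate-≥ k+2≤u)
      where k+2≤u = ≤∧≢⇒< (≰⇒> u≰k) (u≢1+k ∘ sym)

  rotate-unrotate : ∀ u → rotate (unrotate u) ≡ u
  rotate-unrotate zero = rotate-[1+k]
  rotate-unrotate (suc u) = by-cases (u ≤? k)
    where
    by-cases : Dec (u ≤ k) → rotate (unrotate (suc u)) ≡ suc u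
    by-cases (yes u≤k) = trans (cong rotate (unrotate-≤ u≤k)) (rotate-≤ u≤k)
    by-cases (no u≰k) = trans (cong rotate (unrotate-≥ (s≤s (≰⇒> u≰k)))) (rotate-≥ (s≤s (≰⇒> u≰k)))

  rotate-< : ∀ {n u} → suc (suc k) ≤ n → u < n → rotate u < n
  rotate-< {n} {u} k+2≤n u<n with u ≤? k
  ... | yes u≤k = ≤-trans (s≤s (s≤s u≤k)) k+2≤n
  ... | no _ with u ≟ suc k
  ...   | yes _ = ≤-trans (s≤s z≤n) k+2≤n
  ...   | no _ = u<n

  unrotate-< : ∀ {n u} → suc (suc k) ≤ n → u < n → unrotate u < n
  unrotate-< {u = zero} k+2≤n _ = k+2≤n
  unrotate-< {u = suc u} _ u<n with suc u ≤? suc k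
  ... | yes _ = ≤-trans (n≤1+n _) u<n
  ... | no _ = u<n

  module _ {s} (s<k : s < k) where

    private
      s≤k+2 : s ≤ suc (suc k)
      s≤k+2 = ≤-trans (<⇒≤ s<k) (≤-trans (n≤1+n k) (n≤1+n (suc k)))
      s+1≤k+2 : suc s ≤ suc (suc k)
      s+1≤k+2 = s≤s (≤-trans (<⇒≤ s<k) (n≤1+n k))
      s+2≤k+2 : suc (suc s) ≤ suc (suc k)
      s+2≤k+2 = s≤s (s≤s (<⇒≤ s<k))

    module _ {Y} (k+2≤Y : suc (suc k) ≤ Y) where

      rotate-∈-fromBlock : ∀ {U} → U ∈ℕ[ s , Y ] → U ≢ suc k → rotate U ∈ℕ[ suc s , Y ]
      rotate-∈-fromBlock {U} U∈ U≢1+k with ∈ℕ[]-linear⁻ (≤-trans s≤k+2 k+2≤Y) U∈ | rotate-cases U U≢1+k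
      ... | s≤U , _ | inj₁ (U≤k , eq) rewrite eq = ∈ℕ[]-linear⁺ (s≤s s≤U) (≤-trans (s≤s (m≤n⇒m≤1+n U≤k)) k+2≤Y)
      ... | _ , U≤Y | inj₂ (k+2≤U , eq) rewrite eq = ∈ℕ[]-linear⁺ (≤-trans s+1≤k+2 k+2≤U) U≤Y

      unrotate-∈-fromBlock : ∀ {U} → U ∈ℕ[ suc (suc s) , Y ] → U ≢ 0 → unrotate U ∈ℕ[ suc s , Y ]
      unrotate-∈-fromBlock {U} U∈ U≢0 with ∈ℕ[]-linear⁻ (≤-trans s+2≤k+2 k+2≤Y) U∈ | unrotate-cases U U≢0
      ... | s+2≤U , _ | inj₁ (U≤k+1 , eq) = ∈ℕ[]-linear⁺ (≤-pred (subst (suc (suc s) ≤_) (sym eq) s+2≤U))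
          (≤-trans (≤-pred (subst (_≤ suc k) (sym eq) U≤k+1)) (≤-trans (n≤1+n k) (≤-trans (n≤1+n _) k+2≤Y)))
      ... | s+2≤U , U≤Y | inj₂ (_ , eq) rewrite eq = ∈ℕ[]-linear⁺ (≤-trans (n≤1+n _) s+2≤U) U≤Y

      1+k-∈-fromBlock : suc k ∈ℕ[ suc s , Y ]
      1+k-∈-fromBlock = ∈ℕ[]-linear⁺ (≤-trans s<k (n≤1+n k)) (≤-trans (n≤1+n (suc k)) k+2≤Y)

      fromBlock-shrink : ∀ {U} → U ∈ℕ[ suc (suc s) , Y ] → U ∈ℕ[ suc s , Y ]
      fromBlock-shrink U∈ with s+2≤U , U≤Y ← ∈ℕ[]-linear⁻ (≤-trans s+2≤k+2 k+2≤Y) U∈ =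
        ∈ℕ[]-linear⁺ (≤-trans (n≤1+n _) s+2≤U) U≤Y

    module _ {X} (k+2≤X : suc (suc k) ≤ X) where

      private
        s+1<X : suc s < X
        s+1<X = ≤-trans s+2≤k+2 k+2≤X

      rotate-∈-toBlock : ∀ {U} → U ∈ℕ[ X , s ] → U ≢ suc k → rotate U ∈ℕ[ X , suc s ]
      rotate-∈-toBlock {U} U∈ U≢1+k = ∈ℕ[]-wrapping⁺ s+1<X (moved (∈ℕ[]-wrapping⁻ (<-trans (n<1+n s) s+1<X) U∈))
        where
        moved : X ≤ U ⊎ U ≤ s → X ≤ rotate U ⊎ rotate U ≤ suc s
        moved (inj₁ X≤U) with rotate-cases U U≢1+k
        ... | inj₁ (U≤k , _) = ⊥-elim (<⇒≱ (≤-trans (s≤s (m≤n⇒m≤1+n U≤k)) k+2≤X) X≤U)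
        ... | inj₂ (_ , eq) rewrite eq = inj₁ X≤U
        moved (inj₂ U≤s) with rotate-cases U U≢1+k
        ... | inj₁ (_ , eq) rewrite eq = inj₂ (s≤s U≤s)
        ... | inj₂ (k+2≤U , _) = ⊥-elim (<⇒≱ (≤-<-trans U≤s (<-≤-trans (<-trans s<k (n<1+n k)) (<⇒≤ k+2≤U))) ≤-refl)

      unrotate-∈-toBlock : ∀ {U} → U ∈ℕ[ X , suc (suc s) ] → U ≢ 0 → unrotate U ∈ℕ[ X , suc s ]
      unrotate-∈-toBlock {U} U∈ U≢0 = ∈ℕ[]-wrapping⁺ s+1<X (moved (∈ℕ[]-wrapping⁻ (≤-trans (s≤s (s≤s s<k)) k+2≤X) U∈))
        where
        moved : X ≤ U ⊎ U ≤ suc (suc s) → X ≤ unrotate U ⊎ unrotate U ≤ suc s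
        moved (inj₁ X≤U) with unrotate-cases U U≢0
        ... | inj₁ (U≤k+1 , _) = ⊥-elim (<⇒≱ (≤-trans (s≤s U≤k+1) k+2≤X) X≤U)
        ... | inj₂ (_ , eq) rewrite eq = inj₁ X≤U
        moved (inj₂ U≤s+2) with unrotate-cases U U≢0
        ... | inj₁ (_ , eq) = inj₂ (≤-pred (subst (_≤ suc (suc s)) (sym eq) U≤s+2))
        ... | inj₂ (k+2≤U , _) = ⊥-elim (<⇒≱ (s≤s (≤-trans U≤s+2 (s≤s s<k))) k+2≤U)

      toBlock-grow : ∀ {U} → U ∈ℕ[ X , s ] → U ∈ℕ[ X , suc s ]
      toBlock-grow U∈ with ∈ℕ[]-wrapping⁻ (<-trans (n<1+n s) s+1<X) U∈
      ... | inj₁ X≤U = ∈ℕ[]-wrapping⁺ s+1<X (inj₁ X≤U)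
      ... | inj₂ U≤s = ∈ℕ[]-wrapping⁺ s+1<X (inj₂ (m≤n⇒m≤1+n U≤s))

      0-∈-toBlock : 0 ∈ℕ[ X , suc s ]
      0-∈-toBlock = ∈ℕ[]-wrapping⁺ s+1<X (inj₂ z≤n)

  module _ {a c} (k+2≤a : suc (suc k) ≤ a) (k+2≤c : suc (suc k) ≤ c) where

    rotate-∈-offBlock : ∀ {U} → U ∈ℕ[ a , c ] → U ≢ suc k → rotate U ∈ℕ[ a , c ]
    rotate-∈-offBlock {U} U∈ U≢1+k with rotate-cases U U≢1+k
    ... | inj₂ (_ , eq) rewrite eq = U∈
    ... | inj₁ (U≤k , eq) rewrite eq with U∈
    ...   | inj₁ (_ , a≤U , _) = ⊥-elim (<⇒≱ (≤-trans (s≤s (m≤n⇒m≤1+n U≤k)) k+2≤a) a≤U)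
    ...   | inj₂ (c<a , inj₁ a≤U) = ⊥-elim (<⇒≱ (≤-trans (s≤s (m≤n⇒m≤1+n U≤k)) k+2≤a) a≤U)
    ...   | inj₂ (c<a , inj₂ _) = inj₂ (c<a , inj₂ (≤-trans (s≤s (m≤n⇒m≤1+n U≤k)) k+2≤c))

    unrotate-∈-offBlock : ∀ {U} → U ∈ℕ[ a , c ] → U ≢ 0 → unrotate U ∈ℕ[ a , c ]
    unrotate-∈-offBlock {U} U∈ U≢0 with unrotate-cases U U≢0
    ... | inj₂ (_ , eq) rewrite eq = U∈
    ... | inj₁ (U≤k+1 , eq) with U∈
    ...   | inj₁ (_ , a≤U , _) = ⊥-elim (<⇒≱ (≤-trans (s≤s U≤k+1) k+2≤a) a≤U)
    ...   | inj₂ (c<a , inj₁ a≤U) = ⊥-elim (<⇒≱ (≤-trans (s≤s U≤k+1) k+2≤a) a≤U)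
    ...   | inj₂ (c<a , inj₂ U≤c) = inj₂ (c<a , inj₂ (≤-trans (n≤1+n _) (subst (_≤ c) (sym eq) U≤c)))


module BlockIndex (ℓ : ℕ) (i : Fin (len ℓ)) where

  open CyclicDistance
  open import Defs using (len; widx; prev)
  open import Data.Nat using (ℕ; zero; suc; _+_; _*_; _≤_; _<_; s≤s)
  open import Data.Nat.Properties
  open import Data.Nat.DivMod using (_%_; m%n%n≡m%n; [m+n]%n≡m%n; [m+kn]%n≡m%n; m<n⇒m%n≡m; m%n<n; %-distribˡ-*; m*n%n≡0)
  open import Data.Nat.Solver using (module +-*-Solver)
  open +-*-Solver using (solve; _:+_; _:*_; _:=_; con)
  open import Data.Fin using (Fin; toℕ)
  open import Data.Fin.Properties using (toℕ-fromℕ<; toℕ<n; toℕ-injective)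
  open import Data.Product using (∃; _×_; _,_)
  open import Relation.Binary.PropositionalEquality using (_≡_; _≢_; refl; sym; trans; cong; module ≡-Reasoning)

  open ≡-Reasoning

  private
    2*m≢1+2*n : ∀ m n → 2 * m ≢ suc (2 * n)
    2*m≢1+2*n m n eq = 0≢1+n (trans (sym [2*m]%2≡0) (trans (cong (_% 2) eq) [1+2*n]%2≡1))
      where
      [2*m]%2≡0 = trans (cong (_% 2) (*-comm 2 m)) (m*n%n≡0 m 2)
      [1+2*n]%2≡1 = trans (cong (λ z → suc z % 2) (*-comm 2 n)) ([m+kn]%n≡m%n 1 n 2)

  L = len ℓ
  I = toℕ i

  blk : ℕ → Fin L
  blk s = widx ℓ (I + 2 * s)

  toℕ-blk : ∀ s → toℕ (blk s) ≡ (I + 2 * s) % L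
  toℕ-blk s = toℕ-fromℕ< _

  toℕ-prev : ∀ p → toℕ (prev {ℓ} p) ≡ (toℕ p + 2 * ℓ) % L
  toℕ-prev p = toℕ-fromℕ< _

  private
    I≤L : I ≤ L
    I≤L = <⇒≤ (toℕ<n i)

    [m*[n%L]]%L≡[m*n]%L : ∀ m n → (m * (n % L)) % L ≡ (m * n) % L
    [m*[n%L]]%L≡[m*n]%L m n = trans (%-distribˡ-* m (n % L) L)
      (trans (cong (λ z → ((m % L) * z) % L) (m%n%n≡m%n n L)) (sym (%-distribˡ-* m n L)))

    -- 1 + ℓ is the inverse of 2 modulo L = 2ℓ + 1.
    halve : ∀ a d → (a + 2 * ((suc ℓ * d) % L)) % L ≡ (a + d) % L
    halve a d = begin
      (a + 2 * ((suc ℓ * d) % L)) % L    ≡⟨ [k+m%n]%n≡[k+m]%n L a (2 * ((suc ℓ * d) % L)) ⟨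
      (a + (2 * ((suc ℓ * d) % L)) % L) % L ≡⟨ cong (λ z → (a + z) % L) ([m*[n%L]]%L≡[m*n]%L 2 (suc ℓ * d)) ⟩
      (a + (2 * (suc ℓ * d)) % L) % L    ≡⟨ [k+m%n]%n≡[k+m]%n L a (2 * (suc ℓ * d)) ⟩
      (a + 2 * (suc ℓ * d)) % L          ≡⟨ cong (_% L) (solve 3 (λ a d l → a :+ con 2 :* ((con 1 :+ l) :* d) := a :+ d :+ d :* (con 1 :+ con 2 :* l)) refl a d ℓ) ⟩
      (a + d + d * L) % L                ≡⟨ [m+kn]%n≡m%n (a + d) d L ⟩
      (a + d) % L                        ∎

  prev-blk : ∀ u → prev {ℓ} (blk u) ≡ blk (u + ℓ)
  prev-blk u = toℕ-injective (begin
    toℕ (prev {ℓ} (blk u))           ≡⟨ toℕ-prev (blk u) ⟩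
    (toℕ (blk u) + 2 * ℓ) % L        ≡⟨ cong (λ z → (z + 2 * ℓ) % L) (toℕ-blk u) ⟩
    ((I + 2 * u) % L + 2 * ℓ) % L    ≡⟨ [m%n+k]%n≡[m+k]%n L (I + 2 * u) (2 * ℓ) ⟩
    (I + 2 * u + 2 * ℓ) % L          ≡⟨ cong (_% L) (solve 3 (λ a u l → a :+ con 2 :* u :+ con 2 :* l := a :+ con 2 :* (u :+ l)) refl I u ℓ) ⟩
    (I + 2 * (u + ℓ)) % L            ≡⟨ toℕ-blk (u + ℓ) ⟨
    toℕ (blk (u + ℓ))                ∎)

  blk-periodic : ∀ v → blk (suc ℓ + v + ℓ) ≡ blk v
  blk-periodic v = toℕ-injective (begin
    toℕ (blk (suc ℓ + v + ℓ))        ≡⟨ toℕ-blk (suc ℓ + v + ℓ) ⟩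
    (I + 2 * (suc ℓ + v + ℓ)) % L    ≡⟨ cong (_% L) (solve 3 (λ a v l → a :+ con 2 :* ((con 1 :+ l) :+ v :+ l) := a :+ con 2 :* v :+ con 2 :* (con 1 :+ con 2 :* l)) refl I v ℓ) ⟩
    (I + 2 * v + 2 * L) % L          ≡⟨ [m+kn]%n≡m%n (I + 2 * v) 2 L ⟩
    (I + 2 * v) % L                  ≡⟨ toℕ-blk v ⟨
    toℕ (blk v)                      ∎)

  blk-surjective : ∀ p → ∃ λ u → u < L × p ≡ blk u
  blk-surjective p = u , m%n<n (suc ℓ * d) L , toℕ-injective (sym (begin
    toℕ (blk u)        ≡⟨ toℕ-blk u ⟩
    (I + 2 * u) % L    ≡⟨ halve I d ⟩
    (I + d) % L        ≡⟨ +-cdist L (toℕ p) I≤L ⟩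
    toℕ p % L          ≡⟨ m<n⇒m%n≡m (toℕ<n p) ⟩
    toℕ p              ∎))
    where
    d = cdist L I (toℕ p)
    u = (suc ℓ * d) % L

  prev-blk≢blk : ∀ {s s′} → s < ℓ → s′ < ℓ → prev {ℓ} (blk s′) ≢ blk s
  prev-blk≢blk {s} {s′} s<ℓ s′<ℓ eq = differ s′ s′<ℓ (begin
    (I + 2 * s′ + 2 * ℓ) % L         ≡⟨ [m%n+k]%n≡[m+k]%n L (I + 2 * s′) (2 * ℓ) ⟨
    ((I + 2 * s′) % L + 2 * ℓ) % L   ≡⟨ cong (λ z → (z + 2 * ℓ) % L) (toℕ-blk s′) ⟨
    (toℕ (blk s′) + 2 * ℓ) % L       ≡⟨ toℕ-prev (blk s′) ⟨
    toℕ (prev {ℓ} (blk s′))          ≡⟨ cong toℕ eq ⟩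
    toℕ (blk s)                      ≡⟨ toℕ-blk s ⟩
    (I + 2 * s) % L                  ∎)
    where
    offset : ∀ {d} → d < L → (I + d) % L ≡ (I + 2 * s) % L → 2 * s ≡ d
    offset d<L eq′ = trans (sym (cdist-unique L (I + 2 * s) I≤L (s≤s (*-monoʳ-≤ 2 (<⇒≤ s<ℓ))) refl))
                           (cdist-unique L (I + 2 * s) I≤L d<L eq′)
    differ : ∀ t → t < ℓ → (I + 2 * t + 2 * ℓ) % L ≢ (I + 2 * s) % L
    differ zero _ eq′ = <-irrefl (offset ≤-refl (trans (cong (λ z → (z + 2 * ℓ) % L) (sym (+-identityʳ I))) eq′))
                                 (*-monoʳ-< 2 s<ℓ)
    differ (suc t) t<ℓ eq′ = 2*m≢1+2*n s t (offset (s≤s (*-monoʳ-< 2 (<-trans (n<1+n t) t<ℓ)))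
      (trans (sym ([m+n]%n≡m%n (I + suc (2 * t)) L)) (trans (cong (_% L) rearrange) eq′)))
      where
      rearrange : I + suc (2 * t) + L ≡ I + 2 * suc t + 2 * ℓ
      rearrange = solve 3 (λ a b c → a :+ (con 1 :+ con 2 :* b) :+ (con 1 :+ con 2 :* c) := a :+ con 2 :* (con 1 :+ b) :+ con 2 :* c) refl I t ℓ

  -- The progression i, i+2, i+4, … is the sequence 0, 2, 4, … (mod L) started from some c.
  blk-as-doubles : ∀ T → ∃ λ c → c < L × ∀ u → blk u ≡ widx ℓ (2 * ((T + (c + u) % L) % L))
  blk-as-doubles T = c , m%n<n (suc ℓ * d₀) L , λ u → toℕ-injective (begin
    toℕ (blk u)                                 ≡⟨ toℕ-blk u ⟩
    (I + 2 * u) % L                             ≡⟨ cong (λ z → (z + 2 * u) % L) 2T+2c≡I ⟨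
    ((2 * T + 2 * c) % L + 2 * u) % L           ≡⟨ [m%n+k]%n≡[m+k]%n L (2 * T + 2 * c) (2 * u) ⟩
    (2 * T + 2 * c + 2 * u) % L                 ≡⟨ cong (_% L) (solve 3 (λ a b d → con 2 :* a :+ con 2 :* b :+ con 2 :* d := con 2 :* a :+ con 2 :* (b :+ d)) refl T c u) ⟩
    (2 * T + 2 * (c + u)) % L                   ≡⟨ [k+m%n]%n≡[k+m]%n L (2 * T) (2 * (c + u)) ⟨
    (2 * T + (2 * (c + u)) % L) % L             ≡⟨ cong (λ z → (2 * T + z) % L) ([m*[n%L]]%L≡[m*n]%L 2 (c + u)) ⟨
    (2 * T + (2 * ((c + u) % L)) % L) % L       ≡⟨ [k+m%n]%n≡[k+m]%n L (2 * T) (2 * ((c + u) % L)) ⟩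
    (2 * T + 2 * ((c + u) % L)) % L             ≡⟨ cong (_% L) (*-distribˡ-+ 2 T ((c + u) % L)) ⟨
    (2 * (T + (c + u) % L)) % L                 ≡⟨ [m*[n%L]]%L≡[m*n]%L 2 (T + (c + u) % L) ⟨
    (2 * ((T + (c + u) % L) % L)) % L           ≡⟨ toℕ-fromℕ< _ ⟨
    toℕ (widx ℓ (2 * ((T + (c + u) % L) % L)))  ∎)
    where
    d₀ = cdist L ((2 * T) % L) I
    c = (suc ℓ * d₀) % L
    2T+2c≡I : (2 * T + 2 * c) % L ≡ I
    2T+2c≡I = begin
      (2 * T + 2 * c) % L      ≡⟨ halve (2 * T) d₀ ⟩
      (2 * T + d₀) % L         ≡⟨ [m%n+k]%n≡[m+k]%n L (2 * T) d₀ ⟨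
      ((2 * T) % L + d₀) % L   ≡⟨ +-cdist L I (<⇒≤ (m%n<n (2 * T) L)) ⟩
      I % L                    ≡⟨ m<n⇒m%n≡m (toℕ<n i) ⟩
      I                        ∎


-- D u is the position of w_{i+2u}; the arcs of the tuple are [D u, D (u+ℓ)] for u ≤ ℓ and
-- [D (ℓ+1+v), D v] for v < ℓ.

module Cover (ℓ : ℕ) (D : ℕ → ℕ) (D-mono : ∀ {u u′} → u < u′ → u′ < len ℓ → D u < D u′)
  (D-0 : D 0 ≡ 1) where

  open CyclicDistance
  open import Data.Nat using (ℕ; zero; suc; pred; _+_; _*_; _∸_; _≤_; _<_; z≤n; s≤s; _≤?_; _<?_)
  open import Data.Nat.Properties
  open import Data.Product using (∃; _×_; _,_)
  open import Data.Sum using (_⊎_; inj₁; inj₂)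
  open import Relation.Nullary using (yes; no)
  open import Relation.Binary.PropositionalEquality using (_≡_; refl; sym; trans; cong; subst; subst₂)

  L = len ℓ

  ArcEnd : ℕ → ℕ → Set
  ArcEnd u E = (u ≤ ℓ → E ≡ D (u + ℓ)) × (∀ v → u ≡ suc ℓ + v → E ≡ D v)

  private
    2ℓ≡ℓ+ℓ : 2 * ℓ ≡ ℓ + ℓ
    2ℓ≡ℓ+ℓ = cong (λ z → ℓ + z) (+-identityʳ ℓ)

    D-mono-≤ : ∀ {u u′} → u ≤ u′ → u′ < L → D u ≤ D u′
    D-mono-≤ u≤u′ u′<L with m≤n⇒m<n∨m≡n u≤u′
    ... | inj₁ u<u′ = <⇒≤ (D-mono u<u′ u′<L)
    ... | inj₂ refl = ≤-refl

    1≤D : ∀ {u} → u < L → 1 ≤ D u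
    1≤D u<L = subst (_≤ D _) D-0 (D-mono-≤ z≤n u<L)

    halves : ∀ u → u < L → u ≤ ℓ ⊎ ∃ λ v → u ≡ suc ℓ + v × v < ℓ
    halves u u<L with u ≤? ℓ
    ... | yes u≤ℓ = inj₁ u≤ℓ
    ... | no u≰ℓ = inj₂ (u ∸ suc ℓ , sym (m+[n∸m]≡n (≰⇒> u≰ℓ)) ,
      +-cancelˡ-< (suc ℓ) (u ∸ suc ℓ) ℓ (subst₂ _<_ (sym (m+[n∸m]≡n (≰⇒> u≰ℓ))) (cong suc 2ℓ≡ℓ+ℓ) u<L))

  ℓ<L : ℓ < L
  ℓ<L = s≤s (≤-trans (m≤m+n ℓ ℓ) (≤-reflexive (sym 2ℓ≡ℓ+ℓ)))

  u+ℓ<L : ∀ {u} → u ≤ ℓ → u + ℓ < L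
  u+ℓ<L u≤ℓ = s≤s (≤-trans (+-monoˡ-≤ ℓ u≤ℓ) (≤-reflexive (sym 2ℓ≡ℓ+ℓ)))

  D-+ : ∀ a m → a + m < L → D a + m ≤ D (a + m)
  D-+ a zero _ = ≤-reflexive (trans (+-identityʳ (D a)) (cong D (sym (+-identityʳ a))))
  D-+ a (suc m) a+m+1<L = subst (_≤ D (a + suc m)) (sym (+-suc (D a) m))
    (≤-trans (s≤s (D-+ a m (<-trans (+-monoʳ-< a (n<1+n m)) a+m+1<L))) (D-mono (+-monoʳ-< a (n<1+n m)) a+m+1<L))

  cover-1 : 1 ≤ ℓ → ∀ {u E} → u < L → ArcEnd u E → 1 ∈ℕ[ D u , E ] ⊎ suc (D ℓ) ∈ℕ[ D u , E ]
  cover-1 1≤ℓ {u} u<L (end₁ , end₂) with halves u u<L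
  cover-1 1≤ℓ {zero} u<L (end₁ , _) | inj₁ u≤ℓ rewrite end₁ u≤ℓ | D-0 = inj₁ (∈ℕ[]-linear⁺ ≤-refl (1≤D ℓ<L))
  cover-1 1≤ℓ {suc u} u<L (end₁ , _) | inj₁ u≤ℓ rewrite end₁ u≤ℓ =
    inj₂ (∈ℕ[]-linear⁺ (≤-trans (D-mono-≤ u≤ℓ ℓ<L) (n≤1+n _))
                      (≤-trans (D-mono (n<1+n ℓ) (u+ℓ<L 1≤ℓ)) (D-mono-≤ (s≤s (m≤n+m ℓ u)) (u+ℓ<L u≤ℓ))))
  cover-1 1≤ℓ {u} u<L (_ , end₂) | inj₂ (v , refl , v<ℓ) rewrite end₂ v refl =
    inj₁ (∈ℕ[]-wrapping⁺ (D-mono (s≤s (m≤n+m v ℓ)) u<L) (inj₂ (1≤D (<-trans v<ℓ ℓ<L))))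

  cover-2 : ∀ {m} → m < ℓ → ∀ {u E} → u < L → ArcEnd u E → D m ∈ℕ[ D u , E ] ⊎ pred (D (suc m + ℓ)) ∈ℕ[ D u , E ]
  cover-2 {m} m<ℓ {u} u<L (end₁ , end₂) with halves u u<L
  ... | inj₁ u≤ℓ rewrite end₁ u≤ℓ with u ≤? m
  ...   | yes u≤m = inj₁ (∈ℕ[]-linear⁺ (D-mono-≤ u≤m (<-trans m<ℓ ℓ<L)) (D-mono-≤ (≤-trans (<⇒≤ m<ℓ) (m≤n+m ℓ u)) (u+ℓ<L u≤ℓ)))
  ...   | no u≰m = inj₂ (∈ℕ[]-linear⁺ (<⇒≤pred (D-mono (s≤s (≤-trans u≤ℓ (m≤n+m ℓ m))) (u+ℓ<L m<ℓ)))
                                     (≤-trans pred[n]≤n (D-mono-≤ (+-monoˡ-≤ ℓ (≰⇒> u≰m)) (u+ℓ<L u≤ℓ))))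
  cover-2 {m} m<ℓ {u} u<L (end₁ , end₂) | inj₂ (v , refl , v<ℓ) rewrite end₂ v refl with v <? m
  ... | yes v<m = inj₂ (∈ℕ[]-wrapping⁺ (D-mono (s≤s (m≤n+m v ℓ)) u<L)
                   (inj₁ (<⇒≤pred (D-mono (s≤s (subst (_≤ m + ℓ) (cong suc (+-comm v ℓ)) (+-monoˡ-≤ ℓ v<m))) (u+ℓ<L m<ℓ)))))
  ... | no v≮m = inj₁ (∈ℕ[]-wrapping⁺ (D-mono (s≤s (m≤n+m v ℓ)) u<L) (inj₂ (D-mono-≤ (≮⇒≥ v≮m) (<-trans v<ℓ ℓ<L))))


module HittingSets {n ℓ : ℕ} where

  open import Data.Fin.Subset using (Subset; ∣_∣; _∈_)
  open import Data.Product using (∃)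
  open import Relation.Binary.PropositionalEquality using (trans)

  Hits : Tuple n ℓ → Subset n → Fin (len ℓ) → Set
  Hits w e p = ∃ λ x → x ∈ e × x ∈[ w ⟨ p ⟩ , w ⟨ prev {ℓ} p ⟩ ]

  InH-transport : ∀ {r} {w w′ : Tuple n ℓ} {e e′ : Subset n} → ∣ e′ ∣ ≡ ∣ e ∣ →
    (∀ p {x} → x ∈ e → x ∈[ w ⟨ p ⟩ , w ⟨ prev {ℓ} p ⟩ ] → Hits w′ e′ p) → InH r w e → InH r w′ e′
  InH-transport ∣e′∣≡∣e∣ hits (∣e∣≡r , e-hits) = trans ∣e′∣≡∣e∣ ∣e∣≡r , λ p →
    let x , x∈e , x∈arc = e-hits p in hits p x∈e x∈arc


module Shift (n ℓ : ℕ) .{{_ : NonZero n}} (C C₋ C₊ : Tuple n ℓ) (i : Fin (len ℓ)) (k : ℕ)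
  (1≤k : 1 ≤ k) (k≤ℓ : k ≤ ℓ) (j : Fin n) (consecutive : Consecutive C i k j)
  (shift₋ : IsShift C i k j -[1+ 0 ] C₋) (shift₊ : IsShift C i k j (+ 1) C₊)
  (C₋-injective : Injective _≡_ _≡_ (C₋ ⟨_⟩)) (C-injective : Injective _≡_ _≡_ (C ⟨_⟩))
  (C₊-injective : Injective _≡_ _≡_ (C₊ ⟨_⟩)) where

  open Counting
  open Enumeration
  open FinSubset
  open CyclicDistance
  open BlockIndex ℓ i public
  open Rotation
  open HittingSets {n} {ℓ}
  open import Data.Nat using (ℕ; zero; suc; pred; _+_; _*_; _∸_; _≤_; _<_; z≤n; s≤s; NonZero; _≤?_; _<?_; >-nonZero; >-nonZero⁻¹)
  open import Data.Nat.Properties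
  open import Data.Nat.DivMod using (_%_; _mod_; m%n%n≡m%n; [m+n]%n≡m%n; m<n⇒m%n≡m; m%n<n)
  open import Data.Nat.Solver using (module +-*-Solver)
  open +-*-Solver using (solve; _:+_; _:*_; _:=_; con)
  open import Data.Integer as ℤ using (+_; -[1+_])
  open import Data.Fin using (Fin; toℕ; fromℕ<)
  import Data.Fin.Properties as Finₚ
  open import Data.Fin.Properties using (toℕ-fromℕ<; toℕ<n; injective⇒≤)
  open import Data.Fin.Subset using (Subset; ∣_∣; _∈_; _∉_)
  open import Data.Fin.Subset.Properties using (_∈?_)
  open import Data.Fin.Permutation using (Permutation′; permutation; flip; _⟨$⟩ʳ_; _⟨$⟩ˡ_)
  open import Data.Product using (∃; _×_; _,_; proj₁; proj₂)
  open import Data.Sum using (_⊎_; inj₁; inj₂)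
  import Data.Sum as Sum
  open import Data.Empty using (⊥)
  open import Relation.Nullary using (Dec; yes; no; ¬_; ¬?; contradiction)
  open import Relation.Nullary.Decidable using (_×-dec_; _⊎-dec_)
  open import Relation.Binary.PropositionalEquality using (_≡_; _≢_; refl; sym; trans; cong; cong₂; subst; subst₂; module ≡-Reasoning)

  open ≡-Reasoning

  J = toℕ j

  private
    n-1 = n ∸ 1
    1+[n-1]≡n : suc n-1 ≡ n
    1+[n-1]≡n = trans (+-comm 1 n-1) (m∸n+n≡m (>-nonZero⁻¹ n))

  -- Positions are measured clockwise from v_{j-1}.
  b = (J + n-1) % n

  b<n : b < n
  b<n = m%n<n _ n

  open Positions n b b<n public

  k+2≤n : suc (suc k) ≤ n
  k+2≤n = ≤-trans (s≤s (≤-trans (+-mono-≤ (≤-trans 1≤k k≤ℓ) k≤ℓ) (≤-reflexive (cong (λ z → ℓ + z) (sym (+-identityʳ ℓ))))))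
                  (injective⇒≤ C-injective)

  private
    pos-from : ∀ {d} v → d < n → toℕ v % n ≡ (J + n-1 + d) % n → pos v ≡ d
    pos-from v d<n eq = cdist-unique n (toℕ v) (<⇒≤ b<n) d<n (trans ([m%n+k]%n≡[m+k]%n n (J + n-1) _) (sym eq))

    2+s<n : ∀ {s} → s < k → suc (suc s) < n
    2+s<n s<k = ≤-trans (s≤s (s≤s s<k)) k+2≤n

    toℕ-vtx-1 : ∀ a → toℕ (vtx n (+ a ℤ.+ -[1+ 0 ])) ≡ (a + n-1) % n
    toℕ-vtx-1 (suc a) = trans (toℕ-fromℕ< _) (sym (trans (cong (_% n) (trans (sym (+-suc a n-1)) (cong (λ z → a + z) 1+[n-1]≡n)))
                                                              ([m+n]%n≡m%n a n)))
    toℕ-vtx-1 zero = trans (toℕ-fromℕ< _) (-1%m≡m-1 n)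
      where
      -1%m≡m-1 : ∀ m .{{_ : NonZero m}} → -[1+ 0 ] ℤ.%ℕ m ≡ (0 + (m ∸ 1)) % m
      -1%m≡m-1 (suc zero) = refl
      -1%m≡m-1 (suc (suc m)) = sym (m<n⇒m%n≡m (n<1+n (suc m)))

  pos-blk₋ : ∀ {s} → s < k → pos (C₋ ⟨ blk s ⟩) ≡ s
  pos-blk₋ {s} s<k rewrite proj₁ shift₋ s s<k = pos-from _ (<-trans (<-trans (n<1+n s) (n<1+n (suc s))) (2+s<n s<k)) (begin
    toℕ (vtx n (+ (J + s) ℤ.+ -[1+ 0 ])) % n  ≡⟨ cong (_% n) (toℕ-vtx-1 (J + s)) ⟩
    (J + s + n-1) % n % n                       ≡⟨ m%n%n≡m%n (J + s + n-1) n ⟩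
    (J + s + n-1) % n                           ≡⟨ cong (_% n) (solve 3 (λ a c d → a :+ d :+ c := a :+ c :+ d) refl J n-1 s) ⟩
    (J + n-1 + s) % n                           ∎)

  pos-blk : ∀ {s} → s < k → pos (C ⟨ blk s ⟩) ≡ suc s
  pos-blk {s} s<k rewrite consecutive s s<k = pos-from _ (<-trans (n<1+n (suc s)) (2+s<n s<k)) (begin
    toℕ (vtx n (+ (J + s))) % n  ≡⟨ cong (_% n) (toℕ-fromℕ< _) ⟩
    (J + s) % n % n              ≡⟨ m%n%n≡m%n (J + s) n ⟩
    (J + s) % n                  ≡⟨ [m+n]%n≡m%n (J + s) n ⟨
    (J + s + n) % n              ≡⟨ cong (λ z → (J + s + z) % n) 1+[n-1]≡n ⟨
    (J + s + suc n-1) % n        ≡⟨ cong (_% n) (solve 3 (λ a c d → a :+ d :+ (con 1 :+ c) := a :+ c :+ (con 1 :+ d)) refl J n-1 s) ⟩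
    (J + n-1 + suc s) % n        ∎)

  pos-blk₊ : ∀ {s} → s < k → pos (C₊ ⟨ blk s ⟩) ≡ suc (suc s)
  pos-blk₊ {s} s<k rewrite proj₁ shift₊ s s<k = pos-from _ (2+s<n s<k) (begin
    toℕ (vtx n (+ (J + s + 1))) % n  ≡⟨ cong (_% n) (toℕ-fromℕ< _) ⟩
    (J + s + 1) % n % n              ≡⟨ m%n%n≡m%n (J + s + 1) n ⟩
    (J + s + 1) % n                  ≡⟨ [m+n]%n≡m%n (J + s + 1) n ⟨
    (J + s + 1 + n) % n              ≡⟨ cong (λ z → (J + s + 1 + z) % n) 1+[n-1]≡n ⟨
    (J + s + 1 + suc n-1) % n        ≡⟨ cong (_% n) (solve 3 (λ a c d → a :+ d :+ con 1 :+ (con 1 :+ c) := a :+ c :+ (con 2 :+ d)) refl J n-1 s) ⟩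
    (J + n-1 + suc (suc s)) % n      ∎)

  OffBlock : Fin L → Set
  OffBlock q = ∀ s → s < k → q ≢ blk s

  blockIndex? : ∀ q → (∃ λ s → s < k × q ≡ blk s) ⊎ OffBlock q
  blockIndex? q with anyUpTo? (λ s → q Finₚ.≟ blk s) k
  ... | yes in-block = inj₁ in-block
  ... | no ¬in-block = inj₂ (λ s s<k q≡blk → ¬in-block (s , s<k , q≡blk))

  private
    k-1 = pred k
    1+[k-1]≡k : suc k-1 ≡ k
    1+[k-1]≡k = suc-pred k {{>-nonZero 1≤k}}
    k-1<k : k-1 < k
    k-1<k = ≤-reflexive 1+[k-1]≡k

  -- Off the block the three tuples agree, and their entries are distinct from the block
  -- entries of all three, which occupy positions 0, …, k+1.
  pos-offBlock : ∀ q → OffBlock q → suc (suc k) ≤ pos (C ⟨ q ⟩)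
  pos-offBlock q off with suc (suc k) ≤? pos (C ⟨ q ⟩)
  ... | yes k+2≤u = k+2≤u
  ... | no k+2≰u with pos (C ⟨ q ⟩) <? k
  ...   | yes u<k = contradiction (C₋-injective (pos-injective (begin
            pos (C₋ ⟨ q ⟩)      ≡⟨ cong pos (proj₂ shift₋ q off) ⟩
            u                   ≡⟨ pos-blk₋ u<k ⟨
            pos (C₋ ⟨ blk u ⟩)  ∎))) (off u u<k)
    where u = pos (C ⟨ q ⟩)
  ...   | no u≮k with m≤n⇒m<n∨m≡n (≤-pred (≰⇒> k+2≰u))
  ...     | inj₁ u<k+1 = contradiction (C-injective (pos-injective (begin
            pos (C ⟨ q ⟩)        ≡⟨ ≤-antisym (≤-pred u<k+1) (≮⇒≥ u≮k) ⟩
            k                    ≡⟨ 1+[k-1]≡k ⟨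
            suc k-1              ≡⟨ pos-blk k-1<k ⟨
            pos (C ⟨ blk k-1 ⟩)  ∎))) (off k-1 k-1<k)
  ...     | inj₂ u≡k+1 = contradiction (C₊-injective (pos-injective (begin
            pos (C₊ ⟨ q ⟩)        ≡⟨ cong pos (proj₂ shift₊ q off) ⟩
            pos (C ⟨ q ⟩)         ≡⟨ u≡k+1 ⟩
            suc k                 ≡⟨ cong suc 1+[k-1]≡k ⟨
            suc (suc k-1)         ≡⟨ pos-blk₊ k-1<k ⟨
            pos (C₊ ⟨ blk k-1 ⟩)  ∎))) (off k-1 k-1<k)

  -- The positions of the endpoints of the arcs [w_p, w_{p-1}] of C₋, C and C₊: an arc
  -- starts at a block entry, ends at one, or avoids the block.
  data ArcShape (a₋ c₋ a c a₊ c₊ : ℕ) : Set where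
    fromBlock : ∀ {s y} → s < k → suc (suc k) ≤ y →
      a₋ ≡ s → c₋ ≡ y → a ≡ suc s → c ≡ y → a₊ ≡ suc (suc s) → c₊ ≡ y → ArcShape a₋ c₋ a c a₊ c₊
    toBlock : ∀ {s x} → s < k → suc (suc k) ≤ x →
      a₋ ≡ x → c₋ ≡ s → a ≡ x → c ≡ suc s → a₊ ≡ x → c₊ ≡ suc (suc s) → ArcShape a₋ c₋ a c a₊ c₊
    offBlock : ∀ {x y} → suc (suc k) ≤ x → suc (suc k) ≤ y →
      a₋ ≡ x → c₋ ≡ y → a ≡ x → c ≡ y → a₊ ≡ x → c₊ ≡ y → ArcShape a₋ c₋ a c a₊ c₊

  arcShape : ∀ p → ArcShape (pos (C₋ ⟨ p ⟩)) (pos (C₋ ⟨ prev {ℓ} p ⟩)) (pos (C ⟨ p ⟩))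
                            (pos (C ⟨ prev {ℓ} p ⟩)) (pos (C₊ ⟨ p ⟩)) (pos (C₊ ⟨ prev {ℓ} p ⟩))
  arcShape p with blockIndex? p
  ... | inj₁ (s , s<k , refl) = fromBlock s<k (pos-offBlock _ prev-off) (pos-blk₋ s<k)
          (cong pos (proj₂ shift₋ _ prev-off)) (pos-blk s<k) refl (pos-blk₊ s<k) (cong pos (proj₂ shift₊ _ prev-off))
    where
    prev-off : OffBlock (prev {ℓ} (blk s))
    prev-off s′ s′<k = prev-blk≢blk (<-≤-trans s′<k k≤ℓ) (<-≤-trans s<k k≤ℓ)
  ... | inj₂ p-off with blockIndex? (prev {ℓ} p)
  ...   | inj₁ (s , s<k , prev≡blk) = toBlock s<k (pos-offBlock p p-off) (cong pos (proj₂ shift₋ p p-off))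
          (trans (cong (λ q → pos (C₋ ⟨ q ⟩)) prev≡blk) (pos-blk₋ s<k)) refl
          (trans (cong (λ q → pos (C ⟨ q ⟩)) prev≡blk) (pos-blk s<k)) (cong pos (proj₂ shift₊ p p-off))
          (trans (cong (λ q → pos (C₊ ⟨ q ⟩)) prev≡blk) (pos-blk₊ s<k))
  ...   | inj₂ prev-off = offBlock (pos-offBlock p p-off) (pos-offBlock _ prev-off)
          (cong pos (proj₂ shift₋ p p-off)) (cong pos (proj₂ shift₋ _ prev-off)) refl refl
          (cong pos (proj₂ shift₊ p p-off)) (cong pos (proj₂ shift₊ _ prev-off))

  module _ {a₋ c₋ a c a₊ c₊ : ℕ} where

    rotate-arc₋ : ArcShape a₋ c₋ a c a₊ c₊ → ∀ {U} → U ∈ℕ[ a₋ , c₋ ] → U ≢ suc k → rotate k U ∈ℕ[ a , c ]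
    rotate-arc₋ (fromBlock s<k k+2≤y refl refl refl refl refl refl) = rotate-∈-fromBlock k s<k k+2≤y
    rotate-arc₋ (toBlock s<k k+2≤x refl refl refl refl refl refl) = rotate-∈-toBlock k s<k k+2≤x
    rotate-arc₋ (offBlock k+2≤x k+2≤y refl refl refl refl refl refl) = rotate-∈-offBlock k k+2≤x k+2≤y

    unrotate-arc₊ : ArcShape a₋ c₋ a c a₊ c₊ → ∀ {U} → U ∈ℕ[ a₊ , c₊ ] → U ≢ 0 → unrotate k U ∈ℕ[ a , c ]
    unrotate-arc₊ (fromBlock s<k k+2≤y refl refl refl refl refl refl) = unrotate-∈-fromBlock k s<k k+2≤y
    unrotate-arc₊ (toBlock s<k k+2≤x refl refl refl refl refl refl) = unrotate-∈-toBlock k s<k k+2≤x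
    unrotate-arc₊ (offBlock k+2≤x k+2≤y refl refl refl refl refl refl) = unrotate-∈-offBlock k k+2≤x k+2≤y

    arc₋⊆arc∪[1+k] : ArcShape a₋ c₋ a c a₊ c₊ → ∀ {U} → U ∈ℕ[ a₋ , c₋ ] → U ∈ℕ[ a , c ] ⊎ suc k ∈ℕ[ a , c ]
    arc₋⊆arc∪[1+k] (fromBlock s<k k+2≤y refl refl refl refl refl refl) _ = inj₂ (1+k-∈-fromBlock k s<k k+2≤y)
    arc₋⊆arc∪[1+k] (toBlock s<k k+2≤x refl refl refl refl refl refl) U∈ = inj₁ (toBlock-grow k s<k k+2≤x U∈)
    arc₋⊆arc∪[1+k] (offBlock _ _ refl refl refl refl refl refl) U∈ = inj₁ U∈

    arc₊⊆arc∪0 : ArcShape a₋ c₋ a c a₊ c₊ → ∀ {U} → U ∈ℕ[ a₊ , c₊ ] → U ∈ℕ[ a , c ] ⊎ 0 ∈ℕ[ a , c ]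
    arc₊⊆arc∪0 (fromBlock s<k k+2≤y refl refl refl refl refl refl) U∈ = inj₁ (fromBlock-shrink k s<k k+2≤y U∈)
    arc₊⊆arc∪0 (toBlock s<k k+2≤x refl refl refl refl refl refl) _ = inj₂ (0-∈-toBlock k s<k k+2≤x)
    arc₊⊆arc∪0 (offBlock _ _ refl refl refl refl refl refl) U∈ = inj₁ U∈

  rotation : Permutation′ n
  rotation = permutation (λ x → unpos (rotate k (pos x))) (λ x → unpos (unrotate k (pos x)))
    (λ x → begin
      unpos (rotate k (pos (unpos (unrotate k (pos x)))))  ≡⟨ cong (λ u → unpos (rotate k u)) (pos-unpos (unrotate-< k k+2≤n (pos<n x))) ⟩
      unpos (rotate k (unrotate k (pos x)))                ≡⟨ cong unpos (rotate-unrotate k (pos x)) ⟩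
      unpos (pos x)                                        ≡⟨ unpos-pos x ⟩
      x                                                    ∎)
    (λ x → begin
      unpos (unrotate k (pos (unpos (rotate k (pos x)))))  ≡⟨ cong (λ u → unpos (unrotate k u)) (pos-unpos (rotate-< k k+2≤n (pos<n x))) ⟩
      unpos (unrotate k (rotate k (pos x)))                ≡⟨ cong unpos (unrotate-rotate k (pos x)) ⟩
      unpos (pos x)                                        ≡⟨ unpos-pos x ⟩
      x                                                    ∎)

  pos-rotation : ∀ x → pos (rotation ⟨$⟩ʳ x) ≡ rotate k (pos x)
  pos-rotation x = pos-unpos (rotate-< k k+2≤n (pos<n x))

  pos-rotation⁻¹ : ∀ x → pos (rotation ⟨$⟩ˡ x) ≡ unrotate k (pos x)
  pos-rotation⁻¹ x = pos-unpos (unrotate-< k k+2≤n (pos<n x))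

  -- α = v_{j+k} and β = v_{j-1}, the two vertices exchanged between the shifted tuples.
  α β : Fin n
  α = unpos (suc k)
  β = unpos 0

  pos-α : pos α ≡ suc k
  pos-α = pos-unpos k+2≤n

  pos-β : pos β ≡ 0
  pos-β = pos-unpos (≤-trans (s≤s z≤n) k+2≤n)

  private
    pos-member≢pos-absent : ∀ {e : Subset n} {x y} → x ∈ e → y ∉ e → pos x ≢ pos y
    pos-member≢pos-absent {e} x∈e y∉e eq = y∉e (subst (_∈ e) (pos-injective eq) x∈e)

  module _ {r : ℕ} {e : Subset n} where

    InH₋∋α⇒InH : InH r C₋ e → α ∈ e → InH r C e
    InH₋∋α⇒InH h α∈e = InH-transport refl (hits α∈e) h
      where
      hits : α ∈ e → ∀ p {x} → x ∈ e → x ∈[ C₋ ⟨ p ⟩ , C₋ ⟨ prev {ℓ} p ⟩ ] → Hits C e p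
      hits α∈e p {x} x∈e x∈arc with arc₋⊆arc∪[1+k] (arcShape p) (pos-∈[]⁺ x∈arc)
      ... | inj₁ x∈arc′ = x , x∈e , pos-∈[]⁻ x∈arc′
      ... | inj₂ k+1∈arc = α , α∈e , pos-∈[]⁻ (subst (_∈ℕ[ pos (C ⟨ p ⟩) , pos (C ⟨ prev {ℓ} p ⟩) ]) (sym pos-α) k+1∈arc)

    InH₋∌α⇒InH-image : InH r C₋ e → α ∉ e → InH r C (image rotation e)
    InH₋∌α⇒InH-image h α∉e = InH-transport (∣image∣ rotation e) hits h
      where
      hits : ∀ p {x} → x ∈ e → x ∈[ C₋ ⟨ p ⟩ , C₋ ⟨ prev {ℓ} p ⟩ ] → Hits C (image rotation e) p
      hits p {x} x∈e x∈arc = rotation ⟨$⟩ʳ x , ∈-image⁺ rotation x∈e ,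
        pos-∈[]⁻ (subst (_∈ℕ[ pos (C ⟨ p ⟩) , pos (C ⟨ prev {ℓ} p ⟩) ]) (sym (pos-rotation x))
          (rotate-arc₋ (arcShape p) (pos-∈[]⁺ x∈arc) (λ eq → pos-member≢pos-absent x∈e α∉e (trans eq (sym pos-α)))))

    InH₊∋β⇒InH : InH r C₊ e → β ∈ e → InH r C e
    InH₊∋β⇒InH h β∈e = InH-transport refl hits h
      where
      hits : ∀ p {x} → x ∈ e → x ∈[ C₊ ⟨ p ⟩ , C₊ ⟨ prev {ℓ} p ⟩ ] → Hits C e p
      hits p {x} x∈e x∈arc with arc₊⊆arc∪0 (arcShape p) (pos-∈[]⁺ x∈arc)
      ... | inj₁ x∈arc′ = x , x∈e , pos-∈[]⁻ x∈arc′
      ... | inj₂ 0∈arc = β , β∈e , pos-∈[]⁻ (subst (_∈ℕ[ pos (C ⟨ p ⟩) , pos (C ⟨ prev {ℓ} p ⟩) ]) (sym pos-β) 0∈arc)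

    InH₊∌β⇒InH-image : InH r C₊ e → β ∉ e → InH r C (image (flip rotation) e)
    InH₊∌β⇒InH-image h β∉e = InH-transport (∣image∣ (flip rotation) e) hits h
      where
      hits : ∀ p {x} → x ∈ e → x ∈[ C₊ ⟨ p ⟩ , C₊ ⟨ prev {ℓ} p ⟩ ] → Hits C (image (flip rotation) e) p
      hits p {x} x∈e x∈arc = rotation ⟨$⟩ˡ x , ∈-image⁺ (flip rotation) x∈e ,
        pos-∈[]⁻ (subst (_∈ℕ[ pos (C ⟨ p ⟩) , pos (C ⟨ prev {ℓ} p ⟩) ]) (sym (pos-rotation⁻¹ x))
          (unrotate-arc₊ (arcShape p) (pos-∈[]⁺ x∈arc) (λ eq → pos-member≢pos-absent x∈e β∉e (trans eq (sym pos-β)))))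

  image-∌β : ∀ {e} → α ∉ e → β ∉ image rotation e
  image-∌β {e} α∉e β∈image = α∉e (subst (_∈ e) ρ⁻¹β≡α (∈-image⁻ rotation β∈image))
    where
    ρ⁻¹β≡α : rotation ⟨$⟩ˡ β ≡ α
    ρ⁻¹β≡α = cong (λ u → unpos (unrotate k u)) pos-β

  image⁻¹-∌α : ∀ {e} → β ∉ e → α ∉ image (flip rotation) e
  image⁻¹-∌α {e} β∉e α∈image = β∉e (subst (_∈ e) ρα≡β (∈-image⁻ (flip rotation) α∈image))
    where
    ρα≡β : rotation ⟨$⟩ʳ α ≡ β
    ρα≡β = trans (cong (λ u → unpos (rotate k u)) pos-α) (cong unpos (rotate-[1+k] k))

  StrictnessWitness : ℕ → Set
  StrictnessWitness r = (∃ λ e → InH r C e × β ∈ e × ¬ InH r C₊ e)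
                      ⊎ (∃ λ e → InH r C e × α ∈ e × ¬ InH r C₋ e)

  module _ (r : ℕ) where

    private
      H₋? = InH? {n} {ℓ} r C₋
      H? = InH? {n} {ℓ} r C
      H₊? = InH? {n} {ℓ} r C₊
      U = allSubsets n
      x = count (λ e → H? e ×-dec α ∈? e) U
      x′ = count (λ e → H? e ×-dec ¬? (α ∈? e)) U
      y = count (λ e → H? e ×-dec β ∈? e) U
      y′ = count (λ e → H? e ×-dec ¬? (β ∈? e)) U

      module Minus = Exchange (allSubsets-unique n) (allSubsets-complete n) H₋? H? (α ∈?_) (β ∈?_)
        InH₋∋α⇒InH (image rotation) (image-injective rotation) (λ h α∉e → InH₋∌α⇒InH-image h α∉e , image-∌β α∉e)
      module Plus = Exchange (allSubsets-unique n) (allSubsets-complete n) H₊? H? (β ∈?_) (α ∈?_)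
        InH₊∋β⇒InH (image (flip rotation)) (image-injective (flip rotation)) (λ h β∉e → InH₊∌β⇒InH-image h β∉e , image⁻¹-∌α β∉e)

      regroup : (x + y′) + (y + x′) ≡ Hcard r C + Hcard r C
      regroup = begin
        (x + y′) + (y + x′)  ≡⟨ solve 4 (λ a b c d → (a :+ b) :+ (c :+ d) := (a :+ d) :+ (c :+ b)) refl x y′ y x′ ⟩
        (x + x′) + (y + y′)  ≡⟨ cong₂ _+_ (count-split H? (α ∈?_) U) (count-split H? (β ∈?_) U) ⟨
        Hcard r C + Hcard r C ∎

    Hcard₋+Hcard₊≤2Hcard : Hcard r C₋ + Hcard r C₊ ≤ Hcard r C + Hcard r C
    Hcard₋+Hcard₊≤2Hcard = ≤-trans (+-mono-≤ Minus.count-≤-exchange Plus.count-≤-exchange) (≤-reflexive regroup)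

    Hcard₋+Hcard₊<2Hcard : StrictnessWitness r → Hcard r C₋ + Hcard r C₊ < Hcard r C + Hcard r C
    Hcard₋+Hcard₊<2Hcard (inj₁ (e , h , β∈e , ¬h₊)) = <-≤-trans (+-mono-≤-< Minus.count-≤-exchange (Plus.count-<-exchange h β∈e ¬h₊)) (≤-reflexive regroup)
    Hcard₋+Hcard₊<2Hcard (inj₂ (e , h , α∈e , ¬h₋)) = <-≤-trans (+-mono-<-≤ (Minus.count-<-exchange h α∈e ¬h₋) Plus.count-≤-exchange) (≤-reflexive regroup)

  pos-C-positive : ∀ q → 1 ≤ pos (C ⟨ q ⟩)
  pos-C-positive q with blockIndex? q
  ... | inj₁ (s , s<k , refl) = subst (1 ≤_) (sym (pos-blk s<k)) (s≤s z≤n)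
  ... | inj₂ q-off = ≤-trans (s≤s z≤n) (pos-offBlock q q-off)

  module Strict (cyclic : CyclicallyOrdered (λ (q : Fin L) → C ⟨ widx ℓ (2 * toℕ q) ⟩)) where

    D : ℕ → ℕ
    D u = pos (C ⟨ blk u ⟩)

    D-0 : D 0 ≡ 1
    D-0 = pos-blk 1≤k

    private
      T = toℕ (proj₁ cyclic)

      R : ℕ → ℕ
      R v = toℕ (C ⟨ widx ℓ (2 * ((T + v) % L)) ⟩)

      R-mono : ∀ {v v′} → v < v′ → v′ < L → R v < R v′
      R-mono {v} {v′} v<v′ v′<L = subst₂ _<_ (cong (λ q → toℕ (C ⟨ q ⟩)) (index v<L)) (cong (λ q → toℕ (C ⟨ q ⟩)) (index v′<L))
        (proj₂ cyclic (fromℕ< v<L) (fromℕ< v′<L) (subst₂ _<_ (sym (toℕ-fromℕ< v<L)) (sym (toℕ-fromℕ< v′<L)) v<v′))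
        where
        v<L = <-trans v<v′ v′<L
        index : ∀ {w} (w<L : w < L) → widx ℓ (2 * toℕ ((T + toℕ (fromℕ< w<L)) mod L)) ≡ widx ℓ (2 * ((T + w) % L))
        index w<L = cong (λ z → widx ℓ (2 * z)) (trans (toℕ-fromℕ< _) (cong (λ z → (T + z) % L) (toℕ-fromℕ< w<L)))

      c = proj₁ (blk-as-doubles T)
      c<L = proj₁ (proj₂ (blk-as-doubles T))

      toℕ-C-blk : ∀ u → toℕ (C ⟨ blk u ⟩) ≡ R ((c + u) % L)
      toℕ-C-blk u = cong (λ q → toℕ (C ⟨ q ⟩)) (proj₂ (proj₂ (blk-as-doubles T)) u)

      D-1≡cdist : ∀ u → D u ∸ 1 ≡ cdist n (R c) (R ((c + u) % L))
      D-1≡cdist u = begin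
        D u ∸ 1                                              ≡⟨ cdist-≤ n (pos-C-positive (blk u)) (pos<n _) ⟨
        cdist n 1 (D u)                                      ≡⟨ cong (λ z → cdist n z (D u)) D-0 ⟨
        cdist n (D 0) (D u)                                  ≡⟨ cdist-cdist n b<n (toℕ<n _) ⟩
        cdist n (toℕ (C ⟨ blk 0 ⟩)) (toℕ (C ⟨ blk u ⟩))      ≡⟨ cong₂ (cdist n) (toℕ-C-blk 0) (toℕ-C-blk u) ⟩
        cdist n (R ((c + 0) % L)) (R ((c + u) % L))          ≡⟨ cong (λ z → cdist n (R z) (R ((c + u) % L))) (trans (cong (_% L) (+-identityʳ c)) (m<n⇒m%n≡m c<L)) ⟩
        cdist n (R c) (R ((c + u) % L))                      ∎

    D-mono : ∀ {u u′} → u < u′ → u′ < L → D u < D u′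
    D-mono {u} {u′} u<u′ u′<L = subst₂ _<_ (m∸n+n≡m (pos-C-positive (blk u))) (m∸n+n≡m (pos-C-positive (blk u′)))
      (+-monoˡ-< 1 (subst₂ _<_ (sym (D-1≡cdist u)) (sym (D-1≡cdist u′))
        (cdist-rotate-mono n L R (λ _ → toℕ<n _) R-mono c<L u<u′ u′<L)))

    open Cover ℓ D D-mono D-0 using (ArcEnd; ℓ<L; u+ℓ<L; D-+; cover-1; cover-2)

    arcEnd : ∀ u → ArcEnd u (pos (C ⟨ prev {ℓ} (blk u) ⟩))
    arcEnd u = (λ _ → end) , λ v u≡1+ℓ+v → trans end (cong (λ q → pos (C ⟨ q ⟩)) (trans (cong (λ z → blk (z + ℓ)) u≡1+ℓ+v) (blk-periodic v)))
      where
      end : pos (C ⟨ prev {ℓ} (blk u) ⟩) ≡ D (u + ℓ)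
      end = cong (λ q → pos (C ⟨ q ⟩)) (prev-blk u)

    private
      hits-all : ∀ {e} → (∀ {u} → u < L → Hits C e (blk u)) → ∀ p → Hits C e p
      hits-all {e} hits-blk p = let u , u<L , p≡blk-u = blk-surjective p in subst (Hits C e) (sym p≡blk-u) (hits-blk u<L)

      hit-one-of : ∀ {e u a c} → a < n → c < n → unpos a ∈ e → unpos c ∈ e →
        a ∈ℕ[ D u , pos (C ⟨ prev {ℓ} (blk u) ⟩) ] ⊎ c ∈ℕ[ D u , pos (C ⟨ prev {ℓ} (blk u) ⟩) ] → Hits C e (blk u)
      hit-one-of {u = u} a<n _ a∈e _ (inj₁ a∈arc) = unpos _ , a∈e , pos-∈[]⁻ (subst (_∈ℕ[ D u , pos (C ⟨ prev {ℓ} (blk u) ⟩) ]) (sym (pos-unpos a<n)) a∈arc)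
      hit-one-of {u = u} _ c<n _ c∈e (inj₂ c∈arc) = unpos _ , c∈e , pos-∈[]⁻ (subst (_∈ℕ[ D u , pos (C ⟨ prev {ℓ} (blk u) ⟩) ]) (sym (pos-unpos c<n)) c∈arc)

      ranges : ℕ → ℕ → ℕ → ℕ → Subset n
      ranges a b c d = atPositions (λ u → inRange? a b u ⊎-dec inRange? c d u)

      ∣ranges∣ : ∀ {a b c d} → b ≤ c → c ≤ d → d ≤ n → ∣ ranges a b c d ∣ ≡ (b ∸ a) + (d ∸ c)
      ∣ranges∣ b≤c c≤d d≤n = trans (∣atPositions∣ _) (count-inRanges-downFrom b≤c c≤d d≤n)

      ∈-ranges⁻ : ∀ {a b c d x} → x ∈ ranges a b c d → InRange a b (pos x) ⊎ InRange c d (pos x)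
      ∈-ranges⁻ = ∈-subsetOf⁻ _

      unpos-∈-ranges : ∀ {a b c d u} → u < n → InRange a b u ⊎ InRange c d u → unpos u ∈ ranges a b c d
      unpos-∈-ranges u<n u∈ = ∈-subsetOf⁺ _ (subst (λ z → InRange _ _ z ⊎ InRange _ _ z) (sym (pos-unpos u<n)) u∈)

      Y = D ℓ
      Z = D (k + ℓ)

      1≤ℓ : 1 ≤ ℓ
      1≤ℓ = ≤-trans 1≤k k≤ℓ

      1<Y : 1 < Y
      1<Y = subst (_< Y) D-0 (D-mono 1≤ℓ ℓ<L)

      Z<n : Z < n
      Z<n = pos<n _

      pred-∈ : ∀ {lo z} → lo < z → InRange lo z (pred z)
      pred-∈ {z = suc z} (s≤s lo≤z) = lo≤z , ≤-refl

      D-[k-1] : D k-1 ≡ k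
      D-[k-1] = trans (pos-blk k-1<k) 1+[k-1]≡k

      prev-blk-[k+ℓ] : prev {ℓ} (blk (k + ℓ)) ≡ blk k-1
      prev-blk-[k+ℓ] = trans (prev-blk (k + ℓ)) (trans (cong blk k+ℓ+ℓ≡1+ℓ+[k-1]+ℓ) (blk-periodic k-1))
        where
        k+ℓ+ℓ≡1+ℓ+[k-1]+ℓ : k + ℓ + ℓ ≡ suc ℓ + k-1 + ℓ
        k+ℓ+ℓ≡1+ℓ+[k-1]+ℓ = trans (cong (λ z → z + ℓ + ℓ) (sym 1+[k-1]≡k)) (cong (λ z → suc z + ℓ) (+-comm k-1 ℓ))

      pos-C₋-blk-[k+ℓ] : pos (C₋ ⟨ blk (k + ℓ) ⟩) ≡ Z
      pos-C₋-blk-[k+ℓ] = cong pos (proj₂ shift₋ _ (λ s s<k blk≡ →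
        prev-blk≢blk (<-≤-trans k-1<k k≤ℓ) (<-≤-trans s<k k≤ℓ) (trans (cong (prev {ℓ}) (sym blk≡)) prev-blk-[k+ℓ])))

      pos-C₋-prev-blk-[k+ℓ] : pos (C₋ ⟨ prev {ℓ} (blk (k + ℓ)) ⟩) ≡ k-1
      pos-C₋-prev-blk-[k+ℓ] = trans (cong (λ q → pos (C₋ ⟨ q ⟩)) prev-blk-[k+ℓ]) (pos-blk₋ k-1<k)

      pos-C₊-prev-blk-0 : pos (C₊ ⟨ prev {ℓ} (blk 0) ⟩) ≡ Y
      pos-C₊-prev-blk-0 = trans (cong pos (proj₂ shift₊ _ (λ s s<k → prev-blk≢blk (<-≤-trans s<k k≤ℓ) 1≤ℓ)))
                                (cong (λ q → pos (C ⟨ q ⟩)) (prev-blk 0))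

    witness-β : ∀ ρ′ → suc Y + suc ρ′ ≤ n → ∃ λ e → InH (3 + ρ′) C e × β ∈ e × ¬ InH (3 + ρ′) C₊ e
    witness-β ρ′ room = e , (card , hits-all λ {u} u<L → hit-one-of {u = u} 1<n 1+Y<n 1∈e 1+Y∈e (cover-1 1≤ℓ u<L (arcEnd u))) , β∈e , ¬InH₊
      where
      e = ranges 0 2 (suc Y) (suc Y + suc ρ′)
      1+Y<n : suc Y < n
      1+Y<n = <-≤-trans (m<m+n (suc Y) (s≤s z≤n)) room
      1<n : 1 < n
      1<n = <-trans 1<Y (<-trans (n<1+n Y) 1+Y<n)
      card : ∣ e ∣ ≡ 3 + ρ′
      card = trans (∣ranges∣ (≤-trans 1<Y (n≤1+n Y)) (m≤m+n (suc Y) (suc ρ′)) room) (cong (λ m → 2 + m) (m+n∸m≡n (suc Y) (suc ρ′)))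
      1∈e : unpos 1 ∈ e
      1∈e = unpos-∈-ranges 1<n (inj₁ (z≤n , s≤s (s≤s z≤n)))
      1+Y∈e : unpos (suc Y) ∈ e
      1+Y∈e = unpos-∈-ranges 1+Y<n (inj₂ (≤-refl , m<m+n (suc Y) (s≤s z≤n)))
      β∈e : β ∈ e
      β∈e = unpos-∈-ranges (<-trans (s≤s z≤n) 1<n) (inj₁ (z≤n , s≤s z≤n))
      -- The arc [w_i, w_{i-1}] of C₊ is [2, Y] in positions, and e misses it.
      misses : ∀ {u} → 2 ≤ u × u ≤ Y → InRange 0 2 u ⊎ InRange (suc Y) (suc Y + suc ρ′) u → ⊥
      misses (2≤u , _) (inj₁ (_ , u<2)) = <⇒≱ u<2 2≤u
      misses (_ , u≤Y) (inj₂ (Y<u , _)) = <⇒≱ Y<u u≤Y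
      ¬InH₊ : ¬ InH (3 + ρ′) C₊ e
      ¬InH₊ (_ , hits₊) = let x , x∈e , x∈arc = hits₊ (blk 0) in
        misses (∈ℕ[]-linear⁻ 1<Y (subst₂ (λ a c → pos x ∈ℕ[ a , c ]) (pos-blk₊ 1≤k) pos-C₊-prev-blk-0 (pos-∈[]⁺ x∈arc)))
               (∈-ranges⁻ x∈e)

    witness-α : ∀ ρ′ → 3 + ρ′ + k ≤ Z → ∃ λ e → InH (3 + ρ′) C e × α ∈ e × ¬ InH (3 + ρ′) C₋ e
    witness-α ρ′ room = e , (card , hits-all λ {u} u<L → hit-one-of {u = u} (pos<n _) Z-1<n Dk-1∈e Z-1∈e
                                       (Sum.map₂ (subst (_∈ℕ[ D u , pos (C ⟨ prev {ℓ} (blk u) ⟩) ]) Z-1≡)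
                                                 (cover-2 (<-≤-trans k-1<k k≤ℓ) u<L (arcEnd u)))) ,
                        α∈e , ¬InH₋
      where
      ρ = suc ρ′
      lo = Z ∸ ρ
      ρ≤Z : ρ ≤ Z
      ρ≤Z = ≤-trans (m≤n+m ρ 2) (m+n≤o⇒n≤o k (subst (_≤ Z) (+-comm (3 + ρ′) k) room))
      k+2≤lo : 2 + k ≤ lo
      k+2≤lo = m+n≤o⇒m≤o∸n (2 + k) (subst (_≤ Z) (solve 2 (λ r k → con 3 :+ r :+ k := con 2 :+ k :+ (con 1 :+ r)) refl ρ′ k) room)
      lo≤Z : lo ≤ Z
      lo≤Z = m∸n≤m Z ρ
      e = ranges k (2 + k) lo Z
      card : ∣ e ∣ ≡ 3 + ρ′
      card = trans (∣ranges∣ k+2≤lo lo≤Z (<⇒≤ Z<n)) (cong₂ _+_ (m+n∸n≡m 2 k) (m∸[m∸n]≡n ρ≤Z))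
      Z-1<n : pred Z < n
      Z-1<n = ≤-<-trans pred[n]≤n Z<n
      Z-1≡ : pred (D (suc k-1 + ℓ)) ≡ pred Z
      Z-1≡ = cong (λ z → pred (D (z + ℓ))) 1+[k-1]≡k
      Dk-1∈e : unpos (D k-1) ∈ e
      Dk-1∈e = unpos-∈-ranges (pos<n _) (inj₁ (subst (InRange k (2 + k)) (sym D-[k-1]) (≤-refl , s≤s (n≤1+n k))))
      Z-1∈e : unpos (pred Z) ∈ e
      Z-1∈e = unpos-∈-ranges Z-1<n (inj₂ (pred-∈ (∸-monoʳ-< (s≤s z≤n) ρ≤Z)))
      α∈e : α ∈ e
      α∈e = unpos-∈-ranges k+2≤n (inj₁ (n≤1+n k , ≤-refl))
      -- The arc [w_{i+2(k+ℓ)}, w_{i+2(k-1)}] of C₋ is [Z, k − 1] in positions, and e misses it.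
      misses : ∀ {u} → Z ≤ u ⊎ u ≤ k-1 → InRange k (2 + k) u ⊎ InRange lo Z u → ⊥
      misses (inj₁ Z≤u) (inj₁ (_ , u<k+2)) = <⇒≱ (<-≤-trans u<k+2 (≤-trans k+2≤lo lo≤Z)) Z≤u
      misses (inj₁ Z≤u) (inj₂ (_ , u<Z)) = <⇒≱ u<Z Z≤u
      misses (inj₂ u≤k-1) (inj₁ (k≤u , _)) = <⇒≱ (≤-<-trans u≤k-1 k-1<k) k≤u
      misses (inj₂ u≤k-1) (inj₂ (lo≤u , _)) = <⇒≱ (≤-<-trans u≤k-1 (<-≤-trans k-1<k (≤-trans (m≤n+m k 2) k+2≤lo))) lo≤u
      k-1<Z : k-1 < Z
      k-1<Z = <-≤-trans k-1<k (≤-trans (m≤n+m k 2) (≤-trans k+2≤lo lo≤Z))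
      ¬InH₋ : ¬ InH (3 + ρ′) C₋ e
      ¬InH₋ (_ , hits₋) = let x , x∈e , x∈arc = hits₋ (blk (k + ℓ)) in
        misses (∈ℕ[]-wrapping⁻ k-1<Z (subst₂ (λ a c → pos x ∈ℕ[ a , c ]) pos-C₋-blk-[k+ℓ] pos-C₋-prev-blk-[k+ℓ] (pos-∈[]⁺ x∈arc)))
               (∈-ranges⁻ x∈e)

    -- Since n ≥ 3r − 5, if the positions after Y cannot hold r − 2 vertices then Y is large,
    -- and Z = D (k + ℓ) ≥ Y + k leaves room before Z.
    room-before-Z : ∀ ρ′ → 3 * (3 + ρ′) ∸ 5 ≤ n → n < suc Y + suc ρ′ → 3 + ρ′ + k ≤ Z
    room-before-Z ρ′ 3r-5≤n n<1+Y+1+ρ′ = ≤-trans (+-monoˡ-≤ k (+-monoʳ-≤ 3 (m≤m+n ρ′ (ρ′ + 0))))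
                                            (≤-trans (+-monoˡ-≤ k 3+2ρ′≤Y) Y+k≤Z)
      where
      4+3ρ′≤n : 4 + 3 * ρ′ ≤ n
      4+3ρ′≤n = subst (_≤ n) (trans (cong (_∸ 5) (solve 1 (λ a → con 3 :* (con 3 :+ a) := con 5 :+ (con 4 :+ con 3 :* a)) refl ρ′))
                                     (m+n∸m≡n 5 (4 + 3 * ρ′))) 3r-5≤n
      3+2ρ′≤Y : 3 + 2 * ρ′ ≤ Y
      3+2ρ′≤Y = +-cancelʳ-≤ (suc ρ′) (3 + 2 * ρ′) Y
        (subst (_≤ Y + suc ρ′) (solve 1 (λ a → con 4 :+ con 3 :* a := con 3 :+ con 2 :* a :+ (con 1 :+ a)) refl ρ′)
               (≤-trans 4+3ρ′≤n (≤-pred n<1+Y+1+ρ′)))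
      Y+k≤Z : Y + k ≤ Z
      Y+k≤Z = subst (Y + k ≤_) (cong D (+-comm ℓ k)) (D-+ ℓ k (subst (_< L) (+-comm k ℓ) (u+ℓ<L k≤ℓ)))

    strictnessWitness : ∀ r → 3 ≤ r → 3 * r ∸ 5 ≤ n → StrictnessWitness r
    strictnessWitness 1 (s≤s ()) _
    strictnessWitness 2 (s≤s (s≤s ())) _
    strictnessWitness (suc (suc (suc ρ′))) _ 3r-5≤n = by-room (suc Y + suc ρ′ ≤? n)
      where
      by-room : Dec (suc Y + suc ρ′ ≤ n) → StrictnessWitness (3 + ρ′)
      by-room (yes room) = inj₁ (witness-β ρ′ room)
      by-room (no no-room) = inj₂ (witness-α ρ′ (room-before-Z ρ′ 3r-5≤n (≰⇒> no-room)))


m+n≤o+o⇒m⊓n≤o : ∀ {m n o} → m + n ≤ o + o → m ⊓ n ≤ o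
m+n≤o+o⇒m⊓n≤o {m} {n} m+n≤2o = ≮⇒≥ λ o<m⊓n → <⇒≱ (+-mono-< o<m⊓n o<m⊓n) (≤-trans (+-mono-≤ (m⊓n≤m m n) (m⊓n≤n m n)) m+n≤2o)

m+n<o+o⇒m⊓n<o : ∀ {m n o} → m + n < o + o → m ⊓ n < o
m+n<o+o⇒m⊓n<o {m} {n} m+n<2o = ≰⇒> λ o≤m⊓n → <⇒≱ m+n<2o (≤-trans (+-mono-≤ o≤m⊓n o≤m⊓n) (+-mono-≤ (m⊓n≤m m n) (m⊓n≤n m n)))

proposition3p8 : (n ℓ r : ℕ) .{{_ : NonZero n}} → 2 ≤ r → 1 ≤ ℓ →
    (C : Tuple n ℓ) → SemiValid C →
    (i : Fin (len ℓ)) (k : ℕ) → 1 ≤ k → k ≤ ℓ → (j : Fin n) → Consecutive C i k j →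
    (C₋ C₀ C₊ : Tuple n ℓ) →
    IsShift C i k j -[1+ 0 ] C₋ → IsShift C i k j (+ 0) C₀ → IsShift C i k j (+ 1) C₊ →
    SemiValid C₋ → SemiValid C₀ → SemiValid C₊ →
    (Hcard r C₋ ⊓ Hcard r C₊ ≤ Hcard r C)
    × (3 ≤ r → 3 * r ∸ 5 ≤ n → Hcard r C₋ ⊓ Hcard r C₊ < Hcard r C)
proposition3p8 n ℓ r _ _ C (C-injective , cyclic) i k 1≤k k≤ℓ j consecutive C₋ _ C₊ shift₋ _ shift₊
  (C₋-injective , _) _ (C₊-injective , _) =
  m+n≤o+o⇒m⊓n≤o (Hcard₋+Hcard₊≤2Hcard r) ,
  λ 3≤r 3r-5≤n → m+n<o+o⇒m⊓n<o (Hcard₋+Hcard₊<2Hcard r (strictnessWitness r 3≤r 3r-5≤n))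
  where
  open Shift n ℓ C C₋ C₊ i k 1≤k k≤ℓ j consecutive shift₋ shift₊ C₋-injective C-injective C₊-injective
  open Strict cyclic
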